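{- Let $n\ge 3$, $p\ge 0$ and $k\ge 2$ be integers. Then $$C_k(C_n\circledcirc K_p)=\begin{cases}(k-2)n+\left\lfloor\frac{3n+3}{4}\right\rfloor & \text{if } k\le p,\\[2pt] pn & \text{if } k=p+1,\\[2pt] pn+2\left\lceil\frac{n}{2}\right\rceil & \text{if } k=p+2,\end{cases}$$ and $C_n\circledcirc K_p$ is $k$-inconvertible if $k\ge p+3$.
   Context: Irreversible $k$-threshold process on a finite simple graph $G=(V,E)$: start with a set $S_0\subseteq V$ of colored vertices; for $t\ge1$, $S_t$ consists of $S_{t-1}$ together with every vertex having at least $k$ neighbors in $S_{t-1}$. $S_0$ is an irreversible $k$-threshold conversion set if $S_t=V$ for some $t\ge 0$. $C_k(G)$ is the minimum size of such a set. $G$ is $k$-inconvertible if $C_k(G)=|V|$. Double corona product $C_n\circledcirc K_p$: vertices $v_1,\dots,v_n$, $w_1,\dots,w_n$ and $u_i^j$ ($1\le i\le n$, $1\le j\le p$); edges: $v_1\cdots v_n$ forms a cycle, $w_1\cdots w_n$ forms a cycle, each $\{u_i^1,\dots,u_i^p\}$ forms a complete graph $K_p$, and $v_i,w_i$ are each joined to all $u_i^j$; no other edges. For $p=0$ it is two disjoint copies of $C_n$. -}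

module Defs where

open import Data.Bool using (Bool; true; false; _∧_; _∨_; not)
open import Data.Nat using (ℕ; zero; suc; _+_; _*_; _∸_; _≤_; _≤ᵇ_; _≡ᵇ_)
open import Data.Fin using (Fin; toℕ; splitAt; remQuot)
open import Data.Fin.Subset using (Subset; ∣_∣; ⊤)
open import Data.Vec using (tabulate; lookup)
open import Data.Sum using (_⊎_; inj₁; inj₂)
open import Data.Product using (_×_; _,_; ∃; ∃-syntax)
open import Relation.Binary.PropositionalEquality using (_≡_)

-- A finite graph on vertex set Fin size, given by a Boolean adjacency
-- relation.  (The only graph used, the double corona below, is simple:
-- its adjacency is symmetric and irreflexive by construction.)
record Graph : Set where
  constructor mkGraph
  field
    size  : ℕ
    adj   : Fin size → Fin size → Bool
open Graph public

nbrCount : (G : Graph) → Subset (size G) → Fin (size G) → ℕ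
nbrCount G S i = ∣ tabulate (λ j → adj G i j ∧ lookup S j) ∣

step : (G : Graph) → ℕ → Subset (size G) → Subset (size G)
step G k S = tabulate (λ i → lookup S i ∨ (k ≤ᵇ nbrCount G S i))

iter : (G : Graph) → ℕ → ℕ → Subset (size G) → Subset (size G)
iter G k zero    S = S
iter G k (suc t) S = step G k (iter G k t S)

IsConversionSet : (G : Graph) → ℕ → Subset (size G) → Set
IsConversionSet G k S = ∃[ t ] iter G k t S ≡ ⊤

ConvNumberIs : (G : Graph) → ℕ → ℕ → Set
ConvNumberIs G k c =
  (∃[ S ] (IsConversionSet G k S × ∣ S ∣ ≡ c)) ×
  (∀ S → IsConversionSet G k S → c ≤ ∣ S ∣)

Inconvertible : Graph → ℕ → Set
Inconvertible G k = ConvNumberIs G k (size G)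

-- Vertex encoding on Fin (n + n + n * p):
--   first block  : v_i (i : Fin n)
--   second block : w_i (i : Fin n)
--   third block  : u_i^j via remQuot : Fin (n * p) → Fin n × Fin p

data Kind (n p : ℕ) : Set where
  vK : Fin n → Kind n p
  wK : Fin n → Kind n p
  uK : Fin n → Fin p → Kind n p

kind : ∀ n p → Fin (n + n + n * p) → Kind n p
kind n p x with splitAt (n + n) x
... | inj₂ y with remQuot {n} p y
...   | (i , j) = uK i j
kind n p x | inj₁ y with splitAt n y
... | inj₁ i = vK i
... | inj₂ i = wK i

_=ᶠ_ : ∀ {m} → Fin m → Fin m → Bool
a =ᶠ b = toℕ a ≡ᵇ toℕ b

cycAdj : ∀ n → Fin n → Fin n → Bool
cycAdj n i j =
  (suc (toℕ i) ≡ᵇ toℕ j) ∨ (suc (toℕ j) ≡ᵇ toℕ i) ∨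
  ((toℕ i ≡ᵇ 0) ∧ (suc (toℕ j) ≡ᵇ n)) ∨
  ((toℕ j ≡ᵇ 0) ∧ (suc (toℕ i) ≡ᵇ n))

kindAdj : ∀ {n p} → Kind n p → Kind n p → Bool
kindAdj {n} (vK i) (vK j) = cycAdj n i j
kindAdj {n} (wK i) (wK j) = cycAdj n i j
kindAdj {n} (vK i) (wK j) = false
kindAdj {n} (wK i) (vK j) = false
kindAdj {n} (vK i) (uK i' _) = i =ᶠ i'
kindAdj {n} (wK i) (uK i' _) = i =ᶠ i'
kindAdj {n} (uK i _) (vK i') = i =ᶠ i'
kindAdj {n} (uK i _) (wK i') = i =ᶠ i'
kindAdj {n} (uK i a) (uK i' b) = (i =ᶠ i') ∧ not (a =ᶠ b)

dcAdj : ∀ n p → Fin (n + n + n * p) → Fin (n + n + n * p) → Bool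
dcAdj n p x y = kindAdj {n} (kind n p x) (kind n p y)

doubleCorona : ℕ → ℕ → Graph
doubleCorona n p = mkGraph (n + n + n * p) (dcAdj n p)

-- The zero set of a schedule, a map τ from vertices to ℕ in which every vertex with τ x > 0 has
-- at least k neighbours y with τ y < τ x, is a conversion set, and every conversion set contains
-- one (τ x is the first round containing x); so C_k is the least number of zeros of a schedule.
-- For the double corona the schedule condition only involves a group {v_i, w_i, u_i^1, …, u_i^p}
-- and the cycle neighbours of v_i and w_i.
--
-- If k ≥ p + 3 no vertex has k neighbours.  If k = p + 2 every pendant is a zero and an active
-- cycle vertex needs both cycle neighbours earlier; as a cycle edge is earlier for at most one
-- endpoint, at least half of each cycle are zeros.  If k = p + 1 a group has at most one active
-- pendant, which comes after v_i and w_i, so that an active cycle vertex of such a group needs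
-- both cycle neighbours earlier; the same edge count then pays for each active pendant with a
-- zero on the cycles.  If k ≤ p every group has at least k - 2 zeros.  A group with exactly k - 2
-- is a peak on both cycles; a group with k - 1 starts at a cycle vertex having an earlier cycle
-- neighbour and, unless both are earlier, an active partner on the other cycle.  This rules out
-- the excess patterns 00, 010 and 0110 around the cycle, so any four consecutive groups carry
-- at least 3 extra zeros.  Schedules attaining the bounds repeat with period 2 (k > p) or
-- 4 (k ≤ p) along the cycle, adjusted at its end.

{-# OPTIONS --safe #-}
module Submission where

open import Defs
open import Data.Nat using (ℕ; _+_; _*_; _∸_; _≤_; _/_; ⌈_/2⌉)
open import Data.Product using (_×_)
open import Relation.Binary.PropositionalEquality using (_≡_)

open import Data.Bool.Base using (Bool; true; false; not; _∧_; _∨_; if_then_else_)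
open import Data.Bool.Properties using (T-≡; ∧-zeroʳ)
open import Data.Empty using (⊥; ⊥-elim)
open import Data.Fin.Base
  using (Fin; zero; suc; toℕ; fromℕ; inject₁; lower₁; _↑ˡ_; _↑ʳ_; combine; splitAt; punchIn; punchOut)
open import Data.Fin.Properties
  using ( toℕ-injective; toℕ-fromℕ; toℕ-inject₁; toℕ-inject₁-≢; toℕ-lower₁; toℕ<n
        ; punchInᵢ≢i; punchIn-punchOut; punchIn-injective; any?
        ; splitAt-↑ˡ; splitAt-↑ʳ; splitAt⁻¹-↑ˡ; splitAt⁻¹-↑ʳ; remQuot-combine; combine-remQuot )
import Data.Fin.Properties as Fin
open import Data.Fin.Subset using (Subset; ∣_∣; ⊤)
open import Data.Nat.Base
open import Data.Nat.Properties
open import Data.Nat.DivMod using (m<n*o⇒m/o<n; m*n/n≡m; /-monoˡ-≤)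
open import Data.Nat.Induction using (<-wellFounded)
open import Data.Nat.Tactic.RingSolver using (solve-∀)
open import Data.Product.Base using (∃; ∃-syntax; _,_; proj₁; proj₂)
open import Data.Sum.Base using (_⊎_; inj₁; inj₂)
open import Data.Vec.Base using ([]; _∷_; tabulate; lookup)
open import Data.Vec.Properties using (lookup∘tabulate)
open import Function.Base using (_∘_)
open import Function.Bundles using (Equivalence)
open import Induction.WellFounded using (Acc; acc)
open import Level using (0ℓ)
open import Relation.Binary.Definitions using (tri<; tri≈; tri>)
open import Relation.Binary.PropositionalEquality
open import Relation.Nullary.Decidable using (yes; no; _×-dec_)
open import Relation.Nullary.Negation using (¬_; contradiction)
open import Relation.Unary using (Pred; Decidable)

open import Algebra.Properties.CommutativeMonoid.Sum +-0-commutativeMonoid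
  using (sum; sum-cong-≗; ∑-distrib-+; sum-remove; sum-init-last)
open import Algebra.Properties.CommutativeSemigroup +-commutativeSemigroup using (xy∙z≈xz∙y; x∙yz≈yx∙z)

private
  variable
    m c : ℕ

≡ᵇ-true : ∀ {a b} → a ≡ b → (a ≡ᵇ b) ≡ true
≡ᵇ-true {a} {b} a≡b = Equivalence.to T-≡ (≡⇒≡ᵇ a b a≡b)

≡ᵇ-sound : ∀ {a b} → (a ≡ᵇ b) ≡ true → a ≡ b
≡ᵇ-sound {a} {b} eq = ≡ᵇ⇒≡ a b (Equivalence.from T-≡ eq)

≡ᵇ-false : ∀ {a b} → a ≢ b → (a ≡ᵇ b) ≡ false
≡ᵇ-false {a} {b} a≢b with a ≡ᵇ b in eq
... | true  = contradiction (≡ᵇ-sound eq) a≢b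
... | false = refl

<ᵇ-true : ∀ {a b} → a < b → (a <ᵇ b) ≡ true
<ᵇ-true a<b = Equivalence.to T-≡ (<⇒<ᵇ a<b)

<ᵇ-sound : ∀ {a b} → (a <ᵇ b) ≡ true → a < b
<ᵇ-sound {a} {b} eq = <ᵇ⇒< a b (Equivalence.from T-≡ eq)

<ᵇ-false : ∀ {a b} → b ≤ a → (a <ᵇ b) ≡ false
<ᵇ-false {a} {b} b≤a with a <ᵇ b in eq
... | true  = contradiction (<ᵇ-sound eq) (≤⇒≯ b≤a)
... | false = refl

≤ᵇ-true : ∀ {a b} → a ≤ b → (a ≤ᵇ b) ≡ true
≤ᵇ-true {a} {b} a≤b = Equivalence.to T-≡ (≤⇒≤ᵇ a≤b)

≤ᵇ-sound : ∀ {a b} → (a ≤ᵇ b) ≡ true → a ≤ b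
≤ᵇ-sound {a} {b} eq = ≤ᵇ⇒≤ a b (Equivalence.from T-≡ eq)

n≯0⇒n≡0 : ∀ {x} → ¬ 0 < x → x ≡ 0
n≯0⇒n≡0 x≯0 = n≤0⇒n≡0 (≮⇒≥ x≯0)

nonzero⇒active : ∀ {x} → not (x ≡ᵇ 0) ≡ true → 0 < x
nonzero⇒active {suc x} _ = z<s

zero⊎active : ∀ x → x ≡ 0 ⊎ 0 < x
zero⊎active zero    = inj₁ refl
zero⊎active (suc x) = inj₂ z<s

=ᶠ-refl : ∀ {l} (i : Fin l) → (i =ᶠ i) ≡ true
=ᶠ-refl i = ≡ᵇ-true {toℕ i} refl

=ᶠ-≢ : ∀ {l} {i j : Fin l} → i ≢ j → (i =ᶠ j) ≡ false
=ᶠ-≢ i≢j = ≡ᵇ-false (i≢j ∘ toℕ-injective)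

∨-introˡ : ∀ {a b} → a ≡ true → a ∨ b ≡ true
∨-introˡ refl = refl

∨-introʳ : ∀ a {b} → b ≡ true → a ∨ b ≡ true
∨-introʳ true  _ = refl
∨-introʳ false b = b

∧-true : ∀ {a b} → a ∧ b ≡ true → a ≡ true × b ≡ true
∧-true {true} {true} _ = refl , refl

∧-mono : ∀ a {b c} → (b ≡ true → c ≡ true) → a ∧ b ≡ true → a ∧ c ≡ true
∧-mono true b⇒c = b⇒c

sum-mono-≤ : {f g : Fin m → ℕ} → (∀ i → f i ≤ g i) → sum f ≤ sum g
sum-mono-≤ {zero}  f≤g = z≤n
sum-mono-≤ {suc m} f≤g = +-mono-≤ (f≤g zero) (sum-mono-≤ (f≤g ∘ suc))

sum-const : ∀ m c → sum {m} (λ _ → c) ≡ m * c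
sum-const zero    c = refl
sum-const (suc m) c = cong (c +_) (sum-const m c)

sum-zero : {f : Fin m → ℕ} → (∀ i → f i ≡ 0) → sum f ≡ 0
sum-zero {m} f≡0 = trans (sum-cong-≗ f≡0) (trans (sum-const m 0) (*-zeroʳ m))

sum-scaleˡ : ∀ c (f : Fin m → ℕ) → sum (λ i → c * f i) ≡ c * sum f
sum-scaleˡ {zero}  c f = sym (*-zeroʳ c)
sum-scaleˡ {suc m} c f =
  trans (cong (c * f zero +_) (sum-scaleˡ c (f ∘ suc))) (sym (*-distribˡ-+ c (f zero) _))

sum-↑ : ∀ m {n} (f : Fin (m + n) → ℕ) → sum f ≡ sum (λ i → f (i ↑ˡ n)) + sum (λ j → f (m ↑ʳ j))
sum-↑ zero    f = refl
sum-↑ (suc m) f = trans (cong (f zero +_) (sum-↑ m (f ∘ suc))) (sym (+-assoc (f zero) _ _))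

sum-combine : ∀ m {n} (f : Fin (m * n) → ℕ) → sum f ≡ sum (λ i → sum (λ j → f (combine {m} {n} i j)))
sum-combine zero    f = refl
sum-combine (suc m) {n} f =
  trans (sum-↑ n f) (cong (sum (λ j → f (j ↑ˡ (m * n))) +_) (sum-combine m (λ x → f (n ↑ʳ x))))

term≤sum : (f : Fin m → ℕ) (a : Fin m) → f a ≤ sum f
term≤sum {suc m} f a = ≤-trans (m≤m+n (f a) _) (≤-reflexive (sym (sum-remove f)))

pair≤sum : (f : Fin m → ℕ) {a b : Fin m} → a ≢ b → f a + f b ≤ sum f
pair≤sum {suc m} f {a} {b} a≢b = begin
  f a + f b                          ≡⟨ cong (λ c → f a + f c) (punchIn-punchOut a≢b) ⟨
  f a + f (punchIn a (punchOut a≢b)) ≤⟨ +-monoʳ-≤ (f a) (term≤sum (f ∘ punchIn a) _) ⟩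
  f a + sum (f ∘ punchIn a)          ≡⟨ sum-remove f ⟨
  sum f                              ∎
  where open ≤-Reasoning

sum-point : (f : Fin m → ℕ) (a : Fin m) → (∀ i → i ≢ a → f i ≡ 0) → sum f ≡ f a
sum-point {suc m} f a off-a = begin
  sum f                     ≡⟨ sum-remove f ⟩
  f a + sum (f ∘ punchIn a) ≡⟨ cong (f a +_) (sum-zero (λ j → off-a _ (punchInᵢ≢i a j))) ⟩
  f a + 0                   ≡⟨ +-identityʳ (f a) ⟩
  f a                       ∎
  where open ≡-Reasoning

sum-pair : (f : Fin m → ℕ) {a b : Fin m} → a ≢ b → (∀ i → i ≢ a → i ≢ b → f i ≡ 0) → sum f ≡ f a + f b
sum-pair {suc m} f {a} {b} a≢b off-ab = begin
  sum f                     ≡⟨ sum-remove f ⟩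
  f a + sum (f ∘ punchIn a) ≡⟨ cong (f a +_) (sum-point (f ∘ punchIn a) (punchOut a≢b) off-b) ⟩
  f a + f (punchIn a (punchOut a≢b)) ≡⟨ cong (λ c → f a + f c) (punchIn-punchOut a≢b) ⟩
  f a + f b                 ∎
  where
  open ≡-Reasoning
  off-b : ∀ j → j ≢ punchOut a≢b → f (punchIn a j) ≡ 0
  off-b j j≢b′ = off-ab _ (punchInᵢ≢i a j)
    (λ aj≡b → j≢b′ (punchIn-injective a _ _ (trans aj≡b (sym (punchIn-punchOut a≢b)))))

sum-at : (i : Fin m) (g : Fin m → Bool → ℕ) → (∀ i′ → g i′ false ≡ 0) →
         sum (λ i′ → g i′ (i =ᶠ i′)) ≡ g i true
sum-at i g g-false = trans (sum-point _ i (λ i′ i′≢i → trans (cong (g i′) (=ᶠ-≢ (i′≢i ∘ sym))) (g-false i′)))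
                           (cong (g i) (=ᶠ-refl i))

sum-pos : (f : Fin m → ℕ) → 0 < sum f → ∃[ i ] 0 < f i
sum-pos {suc m} f pos with f zero in eq
... | suc _ = zero , subst (0 <_) (sym eq) (s≤s z≤n)
... | zero  with sum-pos (f ∘ suc) pos
...   | i , fi>0 = suc i , fi>0

iverson : Bool → ℕ
iverson true  = 1
iverson false = 0

iverson≤1 : ∀ b → iverson b ≤ 1
iverson≤1 true  = ≤-refl
iverson≤1 false = z≤n

iverson-mono : {a b : Bool} → (a ≡ true → b ≡ true) → iverson a ≤ iverson b
iverson-mono {false} a⇒b = z≤n
iverson-mono {true}  a⇒b rewrite a⇒b refl = ≤-refl

iverson-not : ∀ b → iverson b + iverson (not b) ≡ 1
iverson-not true  = refl
iverson-not false = refl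

iverson-< : ∀ {a b} → a < b → iverson (a <ᵇ b) ≡ 1
iverson-< a<b = cong iverson (<ᵇ-true a<b)

iverson-≥ : ∀ {a b} → b ≤ a → iverson (a <ᵇ b) ≡ 0
iverson-≥ b≤a = cong iverson (<ᵇ-false b≤a)

iverson-both : ∀ a b → 2 ≤ iverson a + iverson b → a ≡ true × b ≡ true
iverson-both true true _ = refl , refl
iverson-both true false (s≤s ())
iverson-both false b 2≤b = contradiction (iverson≤1 b) (<⇒≱ 2≤b)

iverson-<-asym : ∀ a b → iverson (a <ᵇ b) + iverson (b <ᵇ a) ≤ 1
iverson-<-asym a b with <-cmp a b
... | tri< a<b _ _ rewrite iverson-< a<b | iverson-≥ {b} {a} (<⇒≤ a<b) = ≤-refl
... | tri≈ _ refl _ rewrite iverson-≥ {a} {a} ≤-refl = z≤n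
... | tri> _ _ b<a rewrite iverson-≥ {a} {b} (<⇒≤ b<a) | iverson-< b<a = ≤-refl

count : (Fin m → Bool) → ℕ
count P = sum (λ i → iverson (P i))

count-true : ∀ m → count {m} (λ _ → true) ≡ m
count-true m = trans (sum-const m 1) (*-identityʳ m)

count-≤ : (P : Fin m → Bool) → count P ≤ m
count-≤ {m} P = ≤-trans (sum-mono-≤ (λ i → iverson≤1 (P i))) (≤-reflexive (count-true m))

count-mono : {P Q : Fin m → Bool} → (∀ i → P i ≡ true → Q i ≡ true) → count P ≤ count Q
count-mono P⇒Q = sum-mono-≤ (λ i → iverson-mono (P⇒Q i))

count-complement : (P : Fin m → Bool) → count P + count (not ∘ P) ≡ m
count-complement {m} P = begin
  count P + count (not ∘ P)                  ≡⟨ ∑-distrib-+ (λ i → iverson (P i)) _ ⟨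
  sum (λ i → iverson (P i) + iverson (not (P i))) ≡⟨ sum-cong-≗ (λ i → iverson-not (P i)) ⟩
  count {m} (λ _ → true)                     ≡⟨ count-true m ⟩
  m                                          ∎
  where open ≡-Reasoning

count-miss : (P : Fin m → Bool) {a : Fin m} → P a ≡ false → count P < m
count-miss P {a} Pa≡false = begin-strict
  count P                    <⟨ m<m+n (count P) (≤-trans (≤-reflexive (cong (iverson ∘ not) (sym Pa≡false))) (term≤sum _ a)) ⟩
  count P + count (not ∘ P)  ≡⟨ count-complement P ⟩
  _                          ∎
  where open ≤-Reasoning

count-miss₂ : (P : Fin m → Bool) {a b : Fin m} → a ≢ b → P a ≡ false → P b ≡ false → count P + 2 ≤ m
count-miss₂ P {a} {b} a≢b Pa≡false Pb≡false = begin
  count P + 2                  ≡⟨ cong (λ x → count P + x) (cong₂ (λ x y → iverson (not x) + iverson (not y)) Pa≡false Pb≡false) ⟨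
  count P + (iverson (not (P a)) + iverson (not (P b))) ≤⟨ +-monoʳ-≤ (count P) (pair≤sum (λ i → iverson (not (P i))) a≢b) ⟩
  count P + count (not ∘ P)    ≡⟨ count-complement P ⟩
  _                            ∎
  where open ≤-Reasoning

count-≤1 : (P : Fin m → Bool) → (∀ a b → P a ≡ true → P b ≡ true → a ≡ b) → count P ≤ 1
count-≤1 {zero}  P unique = z≤n
count-≤1 {suc m} P unique with P zero in P0
... | true  = ≤-reflexive (cong suc (sum-zero tail≡0))
  where
  tail≡0 : ∀ i → iverson (P (suc i)) ≡ 0
  tail≡0 i with P (suc i) in Pi
  ... | true  with () ← unique zero (suc i) P0 Pi
  ... | false = refl
... | false = count-≤1 (P ∘ suc) (λ a b Pa Pb → Fin.suc-injective (unique (suc a) (suc b) Pa Pb))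

count-pos : (P : Fin m → Bool) → 0 < count P → ∃[ i ] P i ≡ true
count-pos P pos with sum-pos (λ i → iverson (P i)) pos
... | i , Pi>0 with P i in Pi
...   | true = i , Pi

count-toℕ< : ∀ m c → c ≤ m → count {m} (λ j → toℕ j <ᵇ c) ≡ c
count-toℕ< m       zero    _       = sum-zero {m} (λ _ → refl)
count-toℕ< (suc m) (suc c) (s≤s c≤m) = cong suc (count-toℕ< m c c≤m)

argmin : {P : Pred (Fin m) 0ℓ} → Decidable P → (f : Fin m → ℕ) →
         ∃ P → ∃[ a ] P a × (∀ b → P b → f a ≤ f b)
argmin {P = P} P? f (a , Pa) = descend a Pa (<-wellFounded (f a))
  where
  descend : ∀ a → P a → Acc _<_ (f a) → ∃[ a ] P a × (∀ b → P b → f a ≤ f b)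
  descend a Pa (acc below) with any? (λ b → P? b ×-dec f b <? f a)
  ... | yes (b , Pb , fb<fa) = descend b Pb (below fb<fa)
  ... | no  ¬smaller         = a , Pa , λ b Pb → ≮⇒≥ (λ fb<fa → ¬smaller (b , Pb , fb<fa))

-- The cycle

next : Fin (suc m) → Fin (suc m)
next {m} i with m ≟ toℕ i
... | yes _   = zero
... | no  m≢i = suc (lower₁ i m≢i)

prev : Fin (suc m) → Fin (suc m)
prev zero    = fromℕ _
prev (suc i) = inject₁ i

next-fromℕ : ∀ m → next (fromℕ m) ≡ zero
next-fromℕ m with m ≟ toℕ (fromℕ m)
... | yes _   = refl
... | no  m≢m = contradiction (sym (toℕ-fromℕ m)) m≢m

next-inject₁ : (i : Fin m) → next (inject₁ i) ≡ suc i
next-inject₁ {m} i with m ≟ toℕ (inject₁ i)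
... | yes m≡i = contradiction m≡i (toℕ-inject₁-≢ i)
... | no  m≢i = cong suc (toℕ-injective (trans (toℕ-lower₁ _ m≢i) (toℕ-inject₁ i)))

prev-next : (i : Fin (suc m)) → prev (next i) ≡ i
prev-next {m} i with m ≟ toℕ i
... | yes m≡i = toℕ-injective (trans (toℕ-fromℕ m) m≡i)
... | no  m≢i = toℕ-injective (trans (toℕ-inject₁ _) (toℕ-lower₁ i m≢i))

toℕ-next : (i : Fin (suc m)) → toℕ i ≢ m → toℕ (next i) ≡ suc (toℕ i)
toℕ-next {m} i i≢m with m ≟ toℕ i
... | yes m≡i = contradiction (sym m≡i) i≢m
... | no  m≢i = cong suc (toℕ-lower₁ i m≢i)

next-last : (i : Fin (suc m)) → toℕ i ≡ m → next i ≡ zero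
next-last {m} i i≡m with m ≟ toℕ i
... | yes _   = refl
... | no  m≢i = contradiction (sym i≡m) m≢i

sum-next : (f : Fin (suc m) → ℕ) → sum (f ∘ next) ≡ sum f
sum-next {m} f = begin
  sum (f ∘ next)                               ≡⟨ sum-init-last (f ∘ next) ⟩
  sum (f ∘ next ∘ inject₁) + f (next (fromℕ m)) ≡⟨ cong₂ _+_ (sum-cong-≗ (cong f ∘ next-inject₁)) (cong f (next-fromℕ m)) ⟩
  sum (f ∘ suc) + f zero                       ≡⟨ +-comm _ (f zero) ⟩
  sum f                                        ∎
  where open ≡-Reasoning

cycAdj-next : (i : Fin (suc m)) → cycAdj (suc m) i (next i) ≡ true
cycAdj-next {m} i with toℕ i ≟ m
... | yes i≡m rewrite next-last i i≡m =
  ∨-introʳ (1 ≡ᵇ toℕ i) (∨-introʳ ((toℕ i ≡ᵇ 0) ∧ (1 ≡ᵇ suc m)) (≡ᵇ-true i≡m))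
... | no  i≢m rewrite toℕ-next i i≢m = ∨-introˡ (≡ᵇ-true {toℕ i} refl)

cycAdj-prev : (i : Fin (suc m)) → cycAdj (suc m) i (prev i) ≡ true
cycAdj-prev {m} zero    = ∨-introʳ (1 ≡ᵇ toℕ (fromℕ m)) (∨-introˡ (≡ᵇ-true (toℕ-fromℕ m)))
cycAdj-prev     (suc i) = ∨-introʳ (suc (suc (toℕ i)) ≡ᵇ toℕ (inject₁ i)) (∨-introˡ (≡ᵇ-true (toℕ-inject₁ i)))

cycAdj-sound : (i j : Fin (suc m)) → cycAdj (suc m) i j ≡ true → j ≡ next i ⊎ j ≡ prev i
cycAdj-sound {m} i j adj
  with suc (toℕ i) ≡ᵇ toℕ j in e₁ | suc (toℕ j) ≡ᵇ toℕ i in e₂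
     | (toℕ i ≡ᵇ 0) ∧ (toℕ j ≡ᵇ m) in e₃ | (toℕ j ≡ᵇ 0) ∧ (toℕ i ≡ᵇ m) in e₄
... | true  | _     | _     | _    = inj₁ (toℕ-injective (trans (sym (≡ᵇ-sound e₁)) (sym (toℕ-next i i≢m))))
  where
  i≢m : toℕ i ≢ m
  i≢m i≡m = <-irrefl (sym (≡ᵇ-sound e₁)) (subst (λ a → toℕ j < suc a) (sym i≡m) (toℕ<n j))
... | false | true  | _     | _    = inj₂ (below i (≡ᵇ-sound e₂))
  where
  below : ∀ i → suc (toℕ j) ≡ toℕ i → j ≡ prev i
  below (suc i) j+1≡i+1 = toℕ-injective (trans (suc-injective j+1≡i+1) (sym (toℕ-inject₁ i)))
... | false | false | true  | _    with ∧-true e₃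
...   | i≡0 , j≡m = inj₂ (toℕ-injective (trans (≡ᵇ-sound j≡m) (sym (toℕ-prev-zero i (≡ᵇ-sound i≡0)))))
  where
  toℕ-prev-zero : ∀ i → toℕ i ≡ 0 → toℕ (prev i) ≡ m
  toℕ-prev-zero zero _ = toℕ-fromℕ m
cycAdj-sound i j adj | false | false | false | true with ∧-true e₄
...   | j≡0 , i≡m = inj₁ (toℕ-injective (trans (≡ᵇ-sound j≡0) (sym (cong toℕ (next-last i (≡ᵇ-sound i≡m))))))

cycAdj-other : (i j : Fin (suc m)) → j ≢ next i → j ≢ prev i → cycAdj (suc m) i j ≡ false
cycAdj-other i j j≢next j≢prev with cycAdj _ i j in adj
... | false = refl
... | true with cycAdj-sound i j adj
...   | inj₁ j≡next = contradiction j≡next j≢next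
...   | inj₂ j≡prev = contradiction j≡prev j≢prev

next≢prev : 2 ≤ m → (i : Fin (suc m)) → next i ≢ prev i
next≢prev {m} 2≤m zero next≡prev =
  <⇒≢ 2≤m (trans (sym (toℕ-next zero (<⇒≢ (<-≤-trans z<s 2≤m)))) (trans (cong toℕ next≡prev) (toℕ-fromℕ m)))
next≢prev {m} 2≤m (suc i) next≡prev with toℕ (suc i) ≟ m
... | yes i+1≡m = <⇒≢ (s≤s⁻¹ (subst (2 ≤_) (sym i+1≡m) 2≤m)) 0≡i
  where
  0≡i : 0 ≡ toℕ i
  0≡i = begin
    0                      ≡⟨ cong toℕ (next-last (suc i) i+1≡m) ⟨
    toℕ (next (suc i))     ≡⟨ cong toℕ next≡prev ⟩
    toℕ (inject₁ i)        ≡⟨ toℕ-inject₁ i ⟩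
    toℕ i                  ∎
    where open ≡-Reasoning
... | no  i+1≢m = <-irrefl refl (subst (toℕ i <_) i+2≡i (m<n+m (toℕ i) (s≤s z≤n)))
  where
  i+2≡i : 2 + toℕ i ≡ toℕ i
  i+2≡i = trans (sym (toℕ-next (suc i) i+1≢m)) (trans (cong toℕ next≡prev) (toℕ-inject₁ i))

count-cycAdj : 2 ≤ m → (c : Fin (suc m) → Bool) (i : Fin (suc m)) →
               count (λ j → cycAdj (suc m) i j ∧ c j) ≡ iverson (c (next i)) + iverson (c (prev i))
count-cycAdj 2≤m c i = begin
  count (λ j → cycAdj _ i j ∧ c j)
    ≡⟨ sum-pair _ (next≢prev 2≤m i) elsewhere ⟩
  iverson (cycAdj _ i (next i) ∧ c (next i)) + iverson (cycAdj _ i (prev i) ∧ c (prev i))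
    ≡⟨ cong₂ (λ a b → iverson (a ∧ c (next i)) + iverson (b ∧ c (prev i))) (cycAdj-next i) (cycAdj-prev i) ⟩
  iverson (c (next i)) + iverson (c (prev i))
    ∎
  where
  open ≡-Reasoning
  elsewhere : ∀ j → j ≢ next i → j ≢ prev i → iverson (cycAdj _ i j ∧ c j) ≡ 0
  elsewhere j j≢next j≢prev = cong (λ b → iverson (b ∧ c j)) (cycAdj-other i j j≢next j≢prev)

lowerNeighbours : (Fin (suc m) → ℕ) → Fin (suc m) → ℕ
lowerNeighbours f i = iverson (f (next i) <ᵇ f i) + iverson (f (prev i) <ᵇ f i)

-- A cycle edge is counted at most once, by its later endpoint.
sum-lowerNeighbours≤ : (f : Fin (suc m) → ℕ) → sum (lowerNeighbours f) ≤ suc m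
sum-lowerNeighbours≤ {m} f = begin
  sum (lowerNeighbours f)            ≡⟨ ∑-distrib-+ down up ⟩
  sum down + sum up                  ≡⟨ cong (sum down +_) (sum-next up) ⟨
  sum down + sum (up ∘ next)         ≡⟨ cong (sum down +_) (sum-cong-≗ up∘next≗up′) ⟩
  sum down + sum up′                 ≡⟨ ∑-distrib-+ down up′ ⟨
  sum (λ i → down i + up′ i)         ≤⟨ sum-mono-≤ (λ i → iverson-<-asym (f (next i)) (f i)) ⟩
  sum {suc m} (λ _ → 1)              ≡⟨ count-true (suc m) ⟩
  suc m                              ∎
  where
  open ≤-Reasoning
  down up up′ : Fin (suc m) → ℕ
  down i = iverson (f (next i) <ᵇ f i)
  up   i = iverson (f (prev i) <ᵇ f i)
  up′  i = iverson (f i <ᵇ f (next i))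
  up∘next≗up′ : ∀ i → up (next i) ≡ up′ i
  up∘next≗up′ i = cong (λ j → iverson (f j <ᵇ f (next i))) (prev-next i)

sum≤cycle+ : (f g h : Fin (suc m) → ℕ) → (∀ i → g i ≤ lowerNeighbours f i + h i) → sum g ≤ suc m + sum h
sum≤cycle+ {m} f g h local = begin
  sum g                                  ≤⟨ sum-mono-≤ local ⟩
  sum (λ i → lowerNeighbours f i + h i)  ≡⟨ ∑-distrib-+ (lowerNeighbours f) h ⟩
  sum (lowerNeighbours f) + sum h        ≤⟨ +-monoˡ-≤ (sum h) (sum-lowerNeighbours≤ f) ⟩
  suc m + sum h                          ∎
  where open ≤-Reasoning

half≤sum : (f z : Fin (suc m) → ℕ) → (∀ i → 2 ≤ lowerNeighbours f i + 2 * z i) → ⌈ suc m /2⌉ ≤ sum z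
half≤sum {m} f z local = begin
  ⌈ suc m /2⌉         ≤⟨ ⌈n/2⌉-mono (+-cancelˡ-≤ (suc m) (suc m) (sum z + sum z) twice) ⟩
  ⌈ sum z + sum z /2⌉ ≡⟨ n≡⌈n+n/2⌉ (sum z) ⟨
  sum z               ∎
  where
  open ≤-Reasoning
  twice : suc m + suc m ≤ suc m + (sum z + sum z)
  twice = begin
    suc m + suc m                     ≡⟨ trans (sum-const (suc m) 2) (trans (*-comm (suc m) 2) (cong (suc m +_) (+-identityʳ (suc m)))) ⟨
    sum {suc m} (λ _ → 2)             ≤⟨ sum≤cycle+ f (λ _ → 2) (λ i → 2 * z i) local ⟩
    suc m + sum (λ i → 2 * z i)       ≡⟨ cong (suc m +_) (trans (sum-scaleˡ 2 z) (cong (sum z +_) (+-identityʳ (sum z)))) ⟩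
    suc m + (sum z + sum z)           ∎

lower-via-prev : (f : Fin (suc m) → ℕ) (i : Fin (suc m)) {d : ℕ} → 1 + d ≤ lowerNeighbours f i →
                 f i ≤ f (next i) → f (prev i) < f i × d ≡ 0
lower-via-prev f i {d} slack i≤next with f (prev i) <ᵇ f i in lt
... | true  = <ᵇ-sound lt , n≤0⇒n≡0 (s≤s⁻¹ (subst (λ x → 1 + d ≤ x + 1) (iverson-≥ i≤next) slack))
... | false = contradiction (subst (λ x → 1 + d ≤ x + 0) (iverson-≥ i≤next) slack) (λ ())

lower-via-next : (f : Fin (suc m) → ℕ) (i : Fin (suc m)) {d : ℕ} → 1 + d ≤ lowerNeighbours f i →
                 f i ≤ f (prev i) → f (next i) < f i × d ≡ 0
lower-via-next f i {d} slack i≤prev with f (next i) <ᵇ f i in lt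
... | true  = <ᵇ-sound lt , n≤0⇒n≡0 (s≤s⁻¹ (subst (λ x → 1 + d ≤ 1 + x) (iverson-≥ i≤prev) slack))
... | false = contradiction (subst (λ x → 1 + d ≤ 0 + x) (iverson-≥ i≤prev) slack) (λ ())

record SparseZeros (b : Fin (suc m) → ℕ) : Set where
  field
    no-00   : ∀ i → b i ≡ 0 → b (next i) ≡ 0 → ⊥
    no-010  : ∀ i → b i ≡ 0 → b (next i) ≡ 1 → b (next (next i)) ≡ 0 → ⊥
    no-0110 : ∀ i → b i ≡ 0 → b (next i) ≡ 1 → b (next (next i)) ≡ 1 → b (next (next (next i))) ≡ 0 → ⊥

private
  atLeast : ∀ a b c d w x y z → a ≤ w → b ≤ x → c ≤ y → d ≤ z → a + b + c + d ≤ w + x + y + z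
  atLeast _ _ _ _ _ _ _ _ a≤w b≤x c≤y d≤z = +-mono-≤ (+-mono-≤ (+-mono-≤ a≤w b≤x) c≤y) d≤z

window≥3 : ∀ w x y z → (w ≡ 0 → x ≡ 0 → ⊥) → (x ≡ 0 → y ≡ 0 → ⊥) → (y ≡ 0 → z ≡ 0 → ⊥) →
           (w ≡ 0 → x ≡ 1 → y ≡ 0 → ⊥) → (x ≡ 0 → y ≡ 1 → z ≡ 0 → ⊥) → (w ≡ 0 → x ≡ 1 → y ≡ 1 → z ≡ 0 → ⊥) →
           3 ≤ w + x + y + z
window≥3 0 0 _ _ wx _ _ _ _ _ = ⊥-elim (wx refl refl)
window≥3 0 1 0 _ _ _ _ wxy _ _ = ⊥-elim (wxy refl refl refl)
window≥3 0 1 1 0 _ _ _ _ _ wxyz = ⊥-elim (wxyz refl refl refl refl)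
window≥3 0 1 1 (suc z) _ _ _ _ _ _ = atLeast 0 1 1 1 0 1 1 (suc z) z≤n ≤-refl ≤-refl (s≤s z≤n)
window≥3 0 1 (suc (suc y)) z _ _ _ _ _ _ = atLeast 0 1 2 0 0 1 (suc (suc y)) z z≤n ≤-refl (s≤s (s≤s z≤n)) z≤n
window≥3 0 (suc (suc x)) 0 0 _ _ yz _ _ _ = ⊥-elim (yz refl refl)
window≥3 0 (suc (suc x)) (suc y) z _ _ _ _ _ _ = atLeast 0 2 1 0 0 (suc (suc x)) (suc y) z z≤n (s≤s (s≤s z≤n)) (s≤s z≤n) z≤n
window≥3 0 (suc (suc x)) 0 (suc z) _ _ _ _ _ _ = atLeast 0 2 0 1 0 (suc (suc x)) 0 (suc z) z≤n (s≤s (s≤s z≤n)) z≤n (s≤s z≤n)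
window≥3 (suc w) 0 0 z _ xy _ _ _ _ = ⊥-elim (xy refl refl)
window≥3 (suc w) 0 1 0 _ _ _ _ xyz _ = ⊥-elim (xyz refl refl refl)
window≥3 (suc w) 0 1 (suc z) _ _ _ _ _ _ = atLeast 1 0 1 1 (suc w) 0 1 (suc z) (s≤s z≤n) z≤n ≤-refl (s≤s z≤n)
window≥3 (suc w) 0 (suc (suc y)) z _ _ _ _ _ _ = atLeast 1 0 2 0 (suc w) 0 (suc (suc y)) z (s≤s z≤n) z≤n (s≤s (s≤s z≤n)) z≤n
window≥3 (suc w) (suc x) 0 0 _ _ yz _ _ _ = ⊥-elim (yz refl refl)
window≥3 (suc w) (suc x) 0 (suc z) _ _ _ _ _ _ = atLeast 1 1 0 1 (suc w) (suc x) 0 (suc z) (s≤s z≤n) (s≤s z≤n) z≤n (s≤s z≤n)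
window≥3 (suc w) (suc x) (suc y) z _ _ _ _ _ _ = atLeast 1 1 1 0 (suc w) (suc x) (suc y) z (s≤s z≤n) (s≤s z≤n) (s≤s z≤n) z≤n

sum-window : (b : Fin (suc m) → ℕ) → sum (λ i → b i + b (next i) + b (next (next i)) + b (next (next (next i)))) ≡ 4 * sum b
sum-window b = begin
  sum (λ i → b i + b (next i) + b (next (next i)) + b (next (next (next i))))
    ≡⟨ ∑-distrib-+ (λ i → b i + b (next i) + b (next (next i))) b₃ ⟩
  sum (λ i → b i + b (next i) + b (next (next i))) + sum b₃
    ≡⟨ cong (_+ sum b₃) (trans (∑-distrib-+ (λ i → b i + b (next i)) b₂) (cong (_+ sum b₂) (∑-distrib-+ b b₁))) ⟩
  sum b + sum b₁ + sum b₂ + sum b₃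
    ≡⟨ cong₂ (λ x y → sum b + x + y + sum b₃) shift₁ shift₂ ⟩
  sum b + sum b + sum b + sum b₃
    ≡⟨ cong (sum b + sum b + sum b +_) (trans (sum-next b₂) shift₂) ⟩
  sum b + sum b + sum b + sum b
    ≡⟨ four (sum b) ⟩
  4 * sum b ∎
  where
  open ≡-Reasoning
  b₁ b₂ b₃ : Fin (suc _) → ℕ
  b₁ = b ∘ next
  b₂ = b₁ ∘ next
  b₃ = b₂ ∘ next
  shift₁ : sum b₁ ≡ sum b
  shift₁ = sum-next b
  shift₂ : sum b₂ ≡ sum b
  shift₂ = trans (sum-next b₁) shift₁
  four : ∀ x → x + x + x + x ≡ 4 * x
  four = solve-∀

sparseZeros-sum : {b : Fin (suc m) → ℕ} → SparseZeros b → (3 * suc m + 3) / 4 ≤ sum b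
sparseZeros-sum {m} {b} sparse = s≤s⁻¹ (m<n*o⇒m/o<n (begin-strict
  3 * suc m + 3                           <⟨ +-monoʳ-< (3 * suc m) (n<1+n 3) ⟩
  3 * suc m + 4                           ≤⟨ +-monoˡ-≤ 4 (begin
      3 * suc m                           ≡⟨ trans (sum-const (suc m) 3) (*-comm (suc m) 3) ⟨
      sum {suc m} (λ _ → 3)               ≤⟨ sum-mono-≤ window ⟩
      sum (λ i → b i + b (next i) + b (next (next i)) + b (next (next (next i)))) ≡⟨ sum-window b ⟩
      4 * sum b                           ∎) ⟩
  4 * sum b + 4                           ≡⟨ trans (+-comm (4 * sum b) 4) (cong (4 +_) (*-comm 4 (sum b))) ⟩
  suc (sum b) * 4                         ∎))
  where
  open ≤-Reasoning
  open SparseZeros sparse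
  window : ∀ i → 3 ≤ b i + b (next i) + b (next (next i)) + b (next (next (next i)))
  window i = window≥3 _ _ _ _ (no-00 i) (no-00 (next i)) (no-00 (next (next i)))
                              (no-010 i) (no-010 (next i)) (no-0110 i)

-- Activation schedules

∣∣-count : (S : Subset m) → ∣ S ∣ ≡ count (lookup S)
∣∣-count []          = refl
∣∣-count (true ∷ S)  = cong suc (∣∣-count S)
∣∣-count (false ∷ S) = ∣∣-count S

∣tabulate∣ : (P : Fin m → Bool) → ∣ tabulate P ∣ ≡ count P
∣tabulate∣ P = trans (∣∣-count (tabulate P)) (sum-cong-≗ (cong iverson ∘ lookup∘tabulate P))

lookup-⊤ : (x : Fin m) → lookup ⊤ x ≡ true
lookup-⊤ zero    = refl
lookup-⊤ (suc x) = lookup-⊤ x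

all-true : {S : Subset m} → (∀ x → lookup S x ≡ true) → S ≡ ⊤
all-true {S = []}    _   = refl
all-true {S = b ∷ S} all = cong₂ _∷_ (all zero) (all-true (all ∘ suc))

nbrCount-count : (G : Graph) (S : Subset (size G)) (x : Fin (size G)) →
                 nbrCount G S x ≡ count (λ y → adj G x y ∧ lookup S y)
nbrCount-count G S x = ∣tabulate∣ (λ y → adj G x y ∧ lookup S y)

firstTrue : (ℕ → Bool) → ℕ → ℕ
firstTrue f zero    = 0
firstTrue f (suc t) = if f 0 then 0 else suc (firstTrue (f ∘ suc) t)

firstTrue-true : (f : ℕ → Bool) (t : ℕ) → f t ≡ true → f (firstTrue f t) ≡ true
firstTrue-true f zero    ft = ft
firstTrue-true f (suc t) ft with f 0 in f0
... | true  = f0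
... | false = firstTrue-true (f ∘ suc) t ft

firstTrue-≤ : (f : ℕ → Bool) (t s : ℕ) → f s ≡ true → firstTrue f t ≤ s
firstTrue-≤ f zero    s       fs = z≤n
firstTrue-≤ f (suc t) s       fs with f 0 in f0
... | true  = z≤n
firstTrue-≤ f (suc t) zero    fs | false = contradiction (trans (sym fs) f0) (λ ())
firstTrue-≤ f (suc t) (suc s) fs | false = s≤s (firstTrue-≤ (f ∘ suc) t s fs)

module _ (G : Graph) where

  zeroSet : (Fin (size G) → ℕ) → Subset (size G)
  zeroSet τ = tabulate (λ x → τ x ≡ᵇ 0)

  zeros : (Fin (size G) → ℕ) → ℕ
  zeros τ = count (λ x → τ x ≡ᵇ 0)

  earlier : (Fin (size G) → ℕ) → Fin (size G) → ℕ
  earlier τ x = count (λ y → adj G x y ∧ (τ y <ᵇ τ x))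

module _ (G : Graph) (k : ℕ) where

  lookup-step : ∀ S (x : Fin (size G)) → lookup (step G k S) x ≡ lookup S x ∨ (k ≤ᵇ nbrCount G S x)
  lookup-step S = lookup∘tabulate (λ x → lookup S x ∨ (k ≤ᵇ nbrCount G S x))

  step-⊇ : ∀ S (x : Fin (size G)) → lookup S x ≡ true → lookup (step G k S) x ≡ true
  step-⊇ S x x∈S = trans (lookup-step S x) (∨-introˡ x∈S)

  step-new : ∀ S (x : Fin (size G)) → lookup (step G k S) x ≡ true → lookup S x ≡ false → (k ≤ᵇ nbrCount G S x) ≡ true
  step-new S x x∈step x∉S = trans (sym (cong (_∨ (k ≤ᵇ nbrCount G S x)) x∉S)) (trans (sym (lookup-step S x)) x∈step)

  step-threshold : ∀ S (x : Fin (size G)) → k ≤ nbrCount G S x → lookup (step G k S) x ≡ true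
  step-threshold S x k≤ = trans (lookup-step S x) (∨-introʳ (lookup S x) (≤ᵇ-true k≤))

  IsSchedule : (Fin (size G) → ℕ) → Set
  IsSchedule τ = ∀ x → 0 < τ x → k ≤ earlier G τ x

  schedule⇒conversionSet : ∀ τ → IsSchedule τ → IsConversionSet G k (zeroSet G τ)
  schedule⇒conversionSet τ valid = sum τ , all-true (λ x → colouredBy (sum τ) x (term≤sum τ x))
    where
    S : ℕ → Subset (size G)
    S t = iter G k t (zeroSet G τ)
    colouredBy : ∀ t x → τ x ≤ t → lookup (S t) x ≡ true
    colouredBy zero    x τx≤0 = trans (lookup∘tabulate _ x) (≡ᵇ-true (n≤0⇒n≡0 τx≤0))
    colouredBy (suc t) x τx≤t+1 with m≤n⇒m<n∨m≡n τx≤t+1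
    ... | inj₁ τx≤t   = step-⊇ (S t) x (colouredBy t x (s≤s⁻¹ τx≤t))
    ... | inj₂ τx≡t+1 = step-threshold (S t) x (begin
      k                                        ≤⟨ valid x (subst (0 <_) (sym τx≡t+1) z<s) ⟩
      earlier G τ x                            ≤⟨ count-mono (λ y → ∧-mono (adj G x y) (earlier⇒coloured y)) ⟩
      count (λ y → adj G x y ∧ lookup (S t) y) ≡⟨ nbrCount-count G (S t) x ⟨
      nbrCount G (S t) x                       ∎)
      where
      open ≤-Reasoning
      earlier⇒coloured : ∀ y → (τ y <ᵇ τ x) ≡ true → lookup (S t) y ≡ true
      earlier⇒coloured y y<x = colouredBy t y (s≤s⁻¹ (subst (τ y <_) τx≡t+1 (<ᵇ-sound y<x)))

  conversionSet⇒schedule : ∀ S → IsConversionSet G k S →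
                           ∃[ τ ] IsSchedule τ × (∀ x → τ x ≡ 0 → lookup S x ≡ true)
  conversionSet⇒schedule S (t , Sₜ≡⊤) = τ , valid , λ x τx≡0 → subst (λ s → coloured x s ≡ true) τx≡0 (coloured-τ x)
    where
    coloured : Fin (size G) → ℕ → Bool
    coloured x s = lookup (iter G k s S) x
    τ : Fin (size G) → ℕ
    τ x = firstTrue (coloured x) t
    coloured-τ : ∀ x → coloured x (τ x) ≡ true
    coloured-τ x = firstTrue-true (coloured x) t (trans (cong (λ A → lookup A x) Sₜ≡⊤) (lookup-⊤ x))
    valid : IsSchedule τ
    valid x τx>0 with τ x in τx≡ | coloured-τ x
    ... | suc s | x∈Sₛ₊₁ = begin
      k                                            ≤⟨ ≤ᵇ-sound (step-new (iter G k s S) x x∈Sₛ₊₁ x∉Sₛ) ⟩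
      nbrCount G (iter G k s S) x                  ≡⟨ nbrCount-count G (iter G k s S) x ⟩
      count (λ y → adj G x y ∧ coloured y s)       ≤⟨ count-mono (λ y → ∧-mono (adj G x y) (coloured⇒earlier y)) ⟩
      count (λ y → adj G x y ∧ (τ y <ᵇ suc s))     ∎
      where
      open ≤-Reasoning
      coloured⇒earlier : ∀ y → coloured y s ≡ true → (τ y <ᵇ suc s) ≡ true
      coloured⇒earlier y y∈Sₛ = <ᵇ-true (s≤s (firstTrue-≤ (coloured y) t s y∈Sₛ))
      x∉Sₛ : coloured x s ≡ false
      x∉Sₛ with coloured x s in x∈Sₛ
      ... | true  = contradiction (subst (_≤ s) τx≡ (firstTrue-≤ (coloured x) t s x∈Sₛ)) (<-irrefl refl)
      ... | false = refl

  convNumber : (τ : Fin (size G) → ℕ) → IsSchedule τ → zeros G τ ≡ c →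
               (∀ σ → IsSchedule σ → c ≤ zeros G σ) → ConvNumberIs G k c
  convNumber {c = c} τ valid zeros≡c lower =
    (zeroSet G τ , schedule⇒conversionSet τ valid , trans (∣tabulate∣ (λ x → τ x ≡ᵇ 0)) zeros≡c) , minimal
    where
    minimal : ∀ S → IsConversionSet G k S → c ≤ ∣ S ∣
    minimal S conv with conversionSet⇒schedule S conv
    ... | σ , σ-valid , σ⁻¹0⊆S = begin
      c                ≤⟨ lower σ σ-valid ⟩
      zeros G σ        ≤⟨ count-mono (λ x σx≡0 → σ⁻¹0⊆S x (≡ᵇ-sound σx≡0)) ⟩
      count (lookup S) ≡⟨ ∣∣-count S ⟨
      ∣ S ∣            ∎
      where open ≤-Reasoning

-- The double corona

module DoubleCorona (m p : ℕ) where

  n N : ℕ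
  n = suc m
  N = n + n + n * p

  encode : Kind n p → Fin N
  encode (vK i)   = (i ↑ˡ n) ↑ˡ (n * p)
  encode (wK i)   = (n ↑ʳ i) ↑ˡ (n * p)
  encode (uK i j) = (n + n) ↑ʳ combine i j

  kind-encode : ∀ κ → kind n p (encode κ) ≡ κ
  kind-encode (vK i)   rewrite splitAt-↑ˡ (n + n) (i ↑ˡ n) (n * p) | splitAt-↑ˡ n i n = refl
  kind-encode (wK i)   rewrite splitAt-↑ˡ (n + n) (n ↑ʳ i) (n * p) | splitAt-↑ʳ n n i = refl
  kind-encode (uK i j) rewrite splitAt-↑ʳ (n + n) (n * p) (combine i j) =
    cong (λ (i , j) → uK i j) (remQuot-combine {n} {p} i j)

  encode-kind : ∀ x → encode (kind n p x) ≡ x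
  encode-kind x with splitAt (n + n) x in eq₁
  ... | inj₂ y rewrite combine-remQuot {n} p y = splitAt⁻¹-↑ʳ eq₁
  ... | inj₁ y with splitAt n y in eq₂
  ...   | inj₁ i = trans (cong (_↑ˡ (n * p)) (splitAt⁻¹-↑ˡ eq₂)) (splitAt⁻¹-↑ˡ eq₁)
  ...   | inj₂ i = trans (cong (_↑ˡ (n * p)) (splitAt⁻¹-↑ʳ eq₂)) (splitAt⁻¹-↑ˡ eq₁)

  G : Graph
  G = doubleCorona n p

  data Side : Set where
    left right : Side

  flip : Side → Side
  flip left  = right
  flip right = left

  flip-involutive : ∀ s → flip (flip s) ≡ s
  flip-involutive left  = refl
  flip-involutive right = refl

  sameOrFlipped : ∀ s s′ → s′ ≡ s ⊎ s′ ≡ flip s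
  sameOrFlipped left  left  = inj₁ refl
  sameOrFlipped left  right = inj₂ refl
  sameOrFlipped right left  = inj₂ refl
  sameOrFlipped right right = inj₁ refl

  cyc : Side → Fin n → Kind n p
  cyc left  = vK
  cyc right = wK

  sumKind : (Kind n p → ℕ) → ℕ
  sumKind g = sum (g ∘ vK) + sum (g ∘ wK) + sum (λ i → sum (g ∘ uK i))

  sumKind-cong : {g h : Kind n p → ℕ} → (∀ κ → g κ ≡ h κ) → sumKind g ≡ sumKind h
  sumKind-cong g≗h = cong₂ _+_ (cong₂ _+_ (sum-cong-≗ (g≗h ∘ vK)) (sum-cong-≗ (g≗h ∘ wK)))
                               (sum-cong-≗ (λ i → sum-cong-≗ (g≗h ∘ uK i)))

  sum-encode : (f : Fin N → ℕ) → sum f ≡ sumKind (f ∘ encode)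
  sum-encode f = trans (sum-↑ (n + n) f) (cong₂ _+_ (sum-↑ n (λ x → f (x ↑ˡ (n * p)))) (sum-combine n (λ y → f ((n + n) ↑ʳ y))))

  sum-kind : (g : Kind n p → ℕ) → sum (g ∘ kind n p) ≡ sumKind g
  sum-kind g = trans (sum-encode (g ∘ kind n p)) (sumKind-cong (cong g ∘ kind-encode))

  pendants-at : (c : Kind n p → Bool) (i : Fin n) →
                sum (λ i′ → sum (λ j → iverson ((i =ᶠ i′) ∧ c (uK i′ j)))) ≡ count (c ∘ uK i)
  pendants-at c i = sum-at i (λ i′ b → sum (λ j → iverson (b ∧ c (uK i′ j)))) (λ _ → sum-zero {p} (λ _ → refl))

  cycNbrs : (Kind n p → Bool) → Side → Fin n → ℕ
  cycNbrs c s i = count (c ∘ uK i) + (iverson (c (cyc s (next i))) + iverson (c (cyc s (prev i))))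

  pendNbrs : (Kind n p → Bool) → Fin n → Fin p → ℕ
  pendNbrs c i a = count (λ b → not (a =ᶠ b) ∧ c (uK i b)) + (iverson (c (vK i)) + iverson (c (wK i)))

  record IsLocalSchedule (k : ℕ) (T : Kind n p → ℕ) : Set where
    field
      cyc-ok  : ∀ s i → 0 < T (cyc s i) → k ≤ cycNbrs (λ κ → T κ <ᵇ T (cyc s i)) s i
      pend-ok : ∀ i a → 0 < T (uK i a) → k ≤ pendNbrs (λ κ → T κ <ᵇ T (uK i a)) i a

  kindZeros : (Kind n p → ℕ) → ℕ
  kindZeros T = sumKind (λ κ → iverson (T κ ≡ᵇ 0))

  kindZeros-inactive : (T : Kind n p → ℕ) → (∀ κ → T κ ≡ 0) → kindZeros T ≡ N
  kindZeros-inactive T T≡0 = begin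
    kindZeros T                                   ≡⟨ sumKind-cong (λ κ → cong (λ x → iverson (x ≡ᵇ 0)) (T≡0 κ)) ⟩
    sumKind (λ _ → 1)                             ≡⟨ cong₂ _+_ (cong₂ _+_ (count-true n) (count-true n)) pendants ⟩
    N                                             ∎
    where
    open ≡-Reasoning
    pendants : sum {n} (λ _ → count {p} (λ _ → true)) ≡ n * p
    pendants = trans (sum-cong-≗ {n} (λ _ → count-true p)) (sum-const n p)

  inactive-local : ∀ {k} → IsLocalSchedule k (λ _ → 0)
  inactive-local = record { cyc-ok = λ _ _ () ; pend-ok = λ _ _ () }

  zeros-encode : (τ : Fin N → ℕ) → zeros G τ ≡ kindZeros (τ ∘ encode)
  zeros-encode τ = sum-encode (λ x → iverson (τ x ≡ᵇ 0))

  zeros-kind : (T : Kind n p → ℕ) → zeros G (T ∘ kind n p) ≡ kindZeros T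
  zeros-kind T = sum-kind (λ κ → iverson (T κ ≡ᵇ 0))

  module _ (2≤m : 2 ≤ m) where

    nbrs : (c : Kind n p → Bool) (κ : Kind n p) →
           count (λ y → adj G (encode κ) y ∧ c (kind n p y)) ≡ sumKind (λ κ′ → iverson (kindAdj κ κ′ ∧ c κ′))
    nbrs c κ = trans (sum-encode (λ y → iverson (adj G (encode κ) y ∧ c (kind n p y))))
      (sumKind-cong (λ κ′ → cong₂ (λ a b → iverson (kindAdj a b ∧ c b)) (kind-encode κ) (kind-encode κ′)))

    nbrs-cyc : (c : Kind n p → Bool) (s : Side) (i : Fin n) →
               count (λ y → adj G (encode (cyc s i)) y ∧ c (kind n p y)) ≡ cycNbrs c s i
    nbrs-cyc c left i = begin
      _                                    ≡⟨ nbrs c (vK i) ⟩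
      cycle + sum {n} (λ _ → 0) + pendants ≡⟨ cong₂ (λ a b → cycle + a + b) (sum-zero {n} (λ _ → refl)) (pendants-at c i) ⟩
      cycle + 0 + count (c ∘ uK i)         ≡⟨ trans (cong (_+ count (c ∘ uK i)) (+-identityʳ cycle)) (+-comm cycle _) ⟩
      count (c ∘ uK i) + cycle             ≡⟨ cong (count (c ∘ uK i) +_) (count-cycAdj 2≤m (c ∘ vK) i) ⟩
      cycNbrs c left i                     ∎
      where
      open ≡-Reasoning
      cycle = count (λ i′ → cycAdj n i i′ ∧ c (vK i′))
      pendants = sum (λ i′ → sum (λ j → iverson ((i =ᶠ i′) ∧ c (uK i′ j))))
    nbrs-cyc c right i = begin
      _                                    ≡⟨ nbrs c (wK i) ⟩
      sum {n} (λ _ → 0) + cycle + pendants ≡⟨ cong₂ (λ a b → a + cycle + b) (sum-zero {n} (λ _ → refl)) (pendants-at c i) ⟩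
      cycle + count (c ∘ uK i)             ≡⟨ +-comm cycle _ ⟩
      count (c ∘ uK i) + cycle             ≡⟨ cong (count (c ∘ uK i) +_) (count-cycAdj 2≤m (c ∘ wK) i) ⟩
      cycNbrs c right i                    ∎
      where
      open ≡-Reasoning
      cycle = count (λ i′ → cycAdj n i i′ ∧ c (wK i′))
      pendants = sum (λ i′ → sum (λ j → iverson ((i =ᶠ i′) ∧ c (uK i′ j))))

    nbrs-pend : (c : Kind n p → Bool) (i : Fin n) (a : Fin p) →
                count (λ y → adj G (encode (uK i a)) y ∧ c (kind n p y)) ≡ pendNbrs c i a
    nbrs-pend c i a = begin
      _                                  ≡⟨ nbrs c (uK i a) ⟩
      at (c ∘ vK) + at (c ∘ wK) + clique ≡⟨ cong₂ (λ x y → x + y + clique) (at-i (c ∘ vK)) (at-i (c ∘ wK)) ⟩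
      sides + clique                     ≡⟨ cong (sides +_) clique-i ⟩
      sides + count (λ b → not (a =ᶠ b) ∧ c (uK i b)) ≡⟨ +-comm sides _ ⟩
      pendNbrs c i a                     ∎
      where
      open ≡-Reasoning
      at : (Fin n → Bool) → ℕ
      at d = sum (λ i′ → iverson ((i =ᶠ i′) ∧ d i′))
      at-i : ∀ d → at d ≡ iverson (d i)
      at-i d = sum-at i (λ i′ b → iverson (b ∧ d i′)) (λ _ → refl)
      sides = iverson (c (vK i)) + iverson (c (wK i))
      clique = sum (λ i′ → sum (λ b → iverson (((i =ᶠ i′) ∧ not (a =ᶠ b)) ∧ c (uK i′ b))))
      clique-i : clique ≡ count (λ b → not (a =ᶠ b) ∧ c (uK i b))
      clique-i = sum-at i (λ i′ b → sum (λ b′ → iverson ((b ∧ not (a =ᶠ b′)) ∧ c (uK i′ b′)))) (λ _ → sum-zero {p} (λ _ → refl))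

    earlier-encode : (τ : Fin N → ℕ) (κ : Kind n p) →
                     earlier G τ (encode κ) ≡ count (λ y → adj G (encode κ) y ∧ (τ (encode (kind n p y)) <ᵇ τ (encode κ)))
    earlier-encode τ κ = sum-cong-≗ (λ y → cong (λ z → iverson (adj G (encode κ) y ∧ (τ z <ᵇ τ (encode κ)))) (sym (encode-kind y)))

    schedule⇒local : ∀ {k} τ → IsSchedule G k τ → IsLocalSchedule k (τ ∘ encode)
    schedule⇒local {k} τ valid = record
      { cyc-ok  = λ s i pos → subst (k ≤_) (trans (earlier-encode τ (cyc s i)) (nbrs-cyc (earlierThan (cyc s i)) s i)) (valid _ pos)
      ; pend-ok = λ i a pos → subst (k ≤_) (trans (earlier-encode τ (uK i a)) (nbrs-pend (earlierThan (uK i a)) i a)) (valid _ pos)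
      }
      where
      earlierThan : Kind n p → Kind n p → Bool
      earlierThan κ κ′ = τ (encode κ′) <ᵇ τ (encode κ)

    local⇒schedule : ∀ {k} T → IsLocalSchedule k T → IsSchedule G k (T ∘ kind n p)
    local⇒schedule {k} T local x pos =
      subst (λ z → k ≤ count (λ y → adj G z y ∧ (T (kind n p y) <ᵇ T (kind n p x)))) (encode-kind x) (at (kind n p x) pos)
      where
      open IsLocalSchedule local
      at : ∀ κ → 0 < T κ → k ≤ count (λ y → adj G (encode κ) y ∧ (T (kind n p y) <ᵇ T κ))
      at (vK i)   pos = subst (k ≤_) (sym (nbrs-cyc (λ κ → T κ <ᵇ T (vK i)) left i)) (cyc-ok left i pos)
      at (wK i)   pos = subst (k ≤_) (sym (nbrs-cyc (λ κ → T κ <ᵇ T (wK i)) right i)) (cyc-ok right i pos)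
      at (uK i a) pos = subst (k ≤_) (sym (nbrs-pend (λ κ → T κ <ᵇ T (uK i a)) i a)) (pend-ok i a pos)

    convNumber-local : ∀ {k c} (T : Kind n p → ℕ) → IsLocalSchedule k T → kindZeros T ≡ c →
                       (∀ T′ → IsLocalSchedule k T′ → c ≤ kindZeros T′) → ConvNumberIs G k c
    convNumber-local {k} {c} T valid zeros≡c lower =
      convNumber G k (T ∘ kind n p) (local⇒schedule T valid) (trans (zeros-kind T) zeros≡c)
        (λ σ σ-valid → subst (c ≤_) (sym (zeros-encode σ)) (lower (σ ∘ encode) (schedule⇒local σ σ-valid)))

-- Lower bounds

δ₀ : ℕ → ℕ
δ₀ x = iverson (x ≡ᵇ 0)

δ₀-pos : ∀ {x} → 0 < x → δ₀ x ≡ 0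
δ₀-pos {suc x} _ = refl

δ₀≡0⇒active : ∀ {x} → δ₀ x ≡ 0 → 0 < x
δ₀≡0⇒active {suc x} _ = z<s

iverson-before-inactive : ∀ {x τ} → (x < τ → x ≡ 0) → iverson (x <ᵇ τ) ≤ δ₀ x
iverson-before-inactive {x} {τ} inactive with x <ᵇ τ in lt
... | false = z≤n
... | true  = ≤-reflexive (sym (cong δ₀ (inactive (<ᵇ-sound lt))))

module LowerBound (m p k : ℕ) (T : Kind (suc m) p → ℕ) (valid : DoubleCorona.IsLocalSchedule m p k T) where

  open DoubleCorona m p
  open IsLocalSchedule valid

  t : Side → Fin n → ℕ
  t s = T ∘ cyc s

  u : Fin n → Fin p → ℕ
  u i = T ∘ uK i

  zeroPendants : Fin n → ℕ
  zeroPendants i = count (λ j → u i j ≡ᵇ 0)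

  groupZeros : Fin n → ℕ
  groupZeros i = δ₀ (t left i) + δ₀ (t right i) + zeroPendants i

  kindZeros≡sum : kindZeros T ≡ sum groupZeros
  kindZeros≡sum = sym (trans (∑-distrib-+ (λ i → δ₀ (t left i) + δ₀ (t right i)) zeroPendants)
                             (cong (_+ sum zeroPendants) (∑-distrib-+ (δ₀ ∘ t left) (δ₀ ∘ t right))))

  pendantsBefore : Side → Fin n → ℕ
  pendantsBefore s i = count (λ j → u i j <ᵇ t s i)

  cliqueBefore : Fin n → Fin p → ℕ
  cliqueBefore i a = count (λ b → not (a =ᶠ b) ∧ (u i b <ᵇ u i a))

  sidesBefore : Fin n → Fin p → ℕ
  sidesBefore i a = iverson (t left i <ᵇ u i a) + iverson (t right i <ᵇ u i a)

  cyc-valid : ∀ s i → 0 < t s i → k ≤ pendantsBefore s i + lowerNeighbours (t s) i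
  cyc-valid = cyc-ok

  pend-valid : ∀ i a → 0 < u i a → k ≤ cliqueBefore i a + sidesBefore i a
  pend-valid = pend-ok

  pendantsBefore≤p : ∀ s i → pendantsBefore s i ≤ p
  pendantsBefore≤p s i = count-≤ _

  cliqueBefore<p : ∀ i a → cliqueBefore i a < p
  cliqueBefore<p i a = count-miss _ (cong (λ b → not b ∧ (u i a <ᵇ u i a)) (=ᶠ-refl a))

  sidesBefore≤2 : ∀ i a → sidesBefore i a ≤ 2
  sidesBefore≤2 i a = +-mono-≤ (iverson≤1 (t left i <ᵇ u i a)) (iverson≤1 (t right i <ᵇ u i a))

  lowerNeighbours≤2 : ∀ s i → lowerNeighbours (t s) i ≤ 2
  lowerNeighbours≤2 s i = +-mono-≤ (iverson≤1 (t s (next i) <ᵇ t s i)) (iverson≤1 (t s (prev i) <ᵇ t s i))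

  activeCyc⇒k≤p+2 : ∀ s i → 0 < t s i → k ≤ p + 2
  activeCyc⇒k≤p+2 s i pos = ≤-trans (cyc-valid s i pos) (+-mono-≤ (pendantsBefore≤p s i) (lowerNeighbours≤2 s i))

  activePend⇒k≤p+1 : ∀ i a → 0 < u i a → k ≤ p + 1
  activePend⇒k≤p+1 i a pos = begin
    k                                  ≤⟨ pend-valid i a pos ⟩
    cliqueBefore i a + sidesBefore i a ≤⟨ +-monoʳ-≤ (cliqueBefore i a) (sidesBefore≤2 i a) ⟩
    cliqueBefore i a + 2               ≡⟨ +-suc (cliqueBefore i a) 1 ⟩
    suc (cliqueBefore i a) + 1         ≤⟨ +-monoˡ-≤ 1 (cliqueBefore<p i a) ⟩
    p + 1                              ∎
    where open ≤-Reasoning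

  active⇒k≤p+2 : ∀ κ → 0 < T κ → k ≤ p + 2
  active⇒k≤p+2 (vK i)   = activeCyc⇒k≤p+2 left i
  active⇒k≤p+2 (wK i)   = activeCyc⇒k≤p+2 right i
  active⇒k≤p+2 (uK i a) pos = ≤-trans (activePend⇒k≤p+1 i a pos) (+-monoʳ-≤ p (n≤1+n 1))

  inactive : p + 3 ≤ k → ∀ κ → T κ ≡ 0
  inactive p+3≤k κ = n≯0⇒n≡0 (λ pos → 3≰2 (+-cancelˡ-≤ p 3 2 (≤-trans p+3≤k (active⇒k≤p+2 κ pos))))
    where
    3≰2 : ¬ 3 ≤ 2
    3≰2 (s≤s (s≤s ()))

  pendantsInactive : k ≡ p + 2 → ∀ i a → u i a ≡ 0
  pendantsInactive k≡p+2 i a = n≯0⇒n≡0 (λ pos → 2≰1 (+-cancelˡ-≤ p 2 1 (subst (_≤ p + 1) k≡p+2 (activePend⇒k≤p+1 i a pos))))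
    where
    2≰1 : ¬ 2 ≤ 1
    2≰1 (s≤s ())

  bothLowerOrSeed : k ≡ p + 2 → ∀ s i → 2 ≤ lowerNeighbours (t s) i + 2 * δ₀ (t s i)
  bothLowerOrSeed k≡p+2 s i with zero⊎active (t s i)
  ... | inj₁ tᵢ≡0 = subst (λ x → 2 ≤ lowerNeighbours (t s) i + 2 * δ₀ x) (sym tᵢ≡0) (m≤n+m 2 _)
  ... | inj₂ tᵢ>0 = ≤-trans 2≤lower (m≤m+n _ _)
    where
    2≤lower : 2 ≤ lowerNeighbours (t s) i
    2≤lower = +-cancelˡ-≤ p 2 _ (begin
      p + 2                                          ≡⟨ k≡p+2 ⟨
      k                                              ≤⟨ cyc-valid s i tᵢ>0 ⟩
      pendantsBefore s i + lowerNeighbours (t s) i   ≤⟨ +-monoˡ-≤ _ (pendantsBefore≤p s i) ⟩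
      p + lowerNeighbours (t s) i                    ∎)
      where open ≤-Reasoning

  lowerBound-p+2 : k ≡ p + 2 → p * n + 2 * ⌈ n /2⌉ ≤ kindZeros T
  lowerBound-p+2 k≡p+2 = begin
    p * n + 2 * ⌈ n /2⌉                ≡⟨ rearrange p n ⌈ n /2⌉ ⟩
    ⌈ n /2⌉ + ⌈ n /2⌉ + n * p          ≤⟨ +-mono-≤ (+-mono-≤ (half≤sum (t left) (δ₀ ∘ t left) (bothLowerOrSeed k≡p+2 left))
                                                           (half≤sum (t right) (δ₀ ∘ t right) (bothLowerOrSeed k≡p+2 right)))
                                                 (≤-reflexive (sym allPendants)) ⟩
    kindZeros T                        ∎
    where
    open ≤-Reasoning
    rearrange : ∀ p n h → p * n + 2 * h ≡ h + h + n * p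
    rearrange = solve-∀
    allPendants : sum zeroPendants ≡ n * p
    allPendants = trans (sum-cong-≗ (λ i → trans (sum-cong-≗ (λ a → cong δ₀ (pendantsInactive k≡p+2 i a))) (count-true p))) (sum-const n p)

  activePendants : Fin n → ℕ
  activePendants i = count (λ j → not (u i j ≡ᵇ 0))

  zero+activePendants : ∀ i → zeroPendants i + activePendants i ≡ p
  zero+activePendants i = count-complement (λ j → u i j ≡ᵇ 0)

  PendantsQuietBefore : Fin n → ℕ → Set
  PendantsQuietBefore i τ = ∀ j → u i j < τ → u i j ≡ 0

  pendantsBefore-quiet : ∀ {s i} → PendantsQuietBefore i (t s i) → pendantsBefore s i ≤ zeroPendants i
  pendantsBefore-quiet quiet = sum-mono-≤ (λ j → iverson-before-inactive (quiet j))

  cliqueBefore-quiet : ∀ {i a} → PendantsQuietBefore i (u i a) → cliqueBefore i a ≤ zeroPendants i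
  cliqueBefore-quiet {i} {a} quiet = sum-mono-≤ (λ b → ≤-trans (iverson-mono (proj₂ ∘ ∧-true {not (a =ᶠ b)})) (iverson-before-inactive (quiet b)))

  someActivePendant : ∀ i → zeroPendants i < p → ∃[ j ] 0 < u i j
  someActivePendant i zp<p with count-pos (λ j → not (u i j ≡ᵇ 0)) (n≢0⇒n>0 ap≢0)
    where
    ap≢0 : activePendants i ≢ 0
    ap≢0 ap≡0 = <-irrefl (trans (sym (+-identityʳ _)) (trans (cong (zeroPendants i +_) (sym ap≡0)) (zero+activePendants i))) zp<p
  ... | j , active = j , nonzero⇒active active

  firstActivePendant : ∀ i → zeroPendants i < p → ∃[ a ] 0 < u i a × PendantsQuietBefore i (u i a)
  firstActivePendant i zp<p with argmin (λ j → 0 <? u i j) (u i) (someActivePendant i zp<p)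
  ... | a , active , first = a , active , λ j uⱼ<uₐ → n≯0⇒n≡0 (λ pos → <⇒≱ uⱼ<uₐ (first j pos))

  module _ (k≡p+1 : k ≡ p + 1) where

    pendantAfterSides : ∀ i a → 0 < u i a → t left i < u i a × t right i < u i a
    pendantAfterSides i a pos with iverson-both (t left i <ᵇ u i a) (t right i <ᵇ u i a) 2≤sides
      where
      2≤sides : 2 ≤ sidesBefore i a
      2≤sides = +-cancelˡ-≤ (cliqueBefore i a) 2 _ (begin
        cliqueBefore i a + 2        ≡⟨ +-suc (cliqueBefore i a) 1 ⟩
        suc (cliqueBefore i a) + 1  ≤⟨ +-monoˡ-≤ 1 (cliqueBefore<p i a) ⟩
        p + 1                       ≡⟨ k≡p+1 ⟨
        k                           ≤⟨ pend-valid i a pos ⟩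
        cliqueBefore i a + sidesBefore i a ∎)
        where open ≤-Reasoning
    ... | l<a , r<a = <ᵇ-sound l<a , <ᵇ-sound r<a

    pendantAfter : ∀ s i a → 0 < u i a → t s i < u i a
    pendantAfter left  i a pos = proj₁ (pendantAfterSides i a pos)
    pendantAfter right i a pos = proj₂ (pendantAfterSides i a pos)

    activePendant-last : ∀ i a b → a ≢ b → 0 < u i a → u i b < u i a
    activePendant-last i a b a≢b pos = ≰⇒> (λ uₐ≤u_b → <⇒≱ (begin-strict
      cliqueBefore i a + sidesBefore i a ≤⟨ +-monoʳ-≤ (cliqueBefore i a) (sidesBefore≤2 i a) ⟩
      cliqueBefore i a + 2               ≤⟨ count-miss₂ _ a≢b (cong (λ b → not b ∧ (u i a <ᵇ u i a)) (=ᶠ-refl a))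
                                                              (trans (cong (not (a =ᶠ b) ∧_) (<ᵇ-false uₐ≤u_b)) (∧-zeroʳ _)) ⟩
      p                                  <⟨ n<1+n p ⟩
      suc p                              ≡⟨ trans (+-comm 1 p) (sym k≡p+1) ⟩
      k                                  ∎) (pend-valid i a pos))
      where open ≤-Reasoning

    activePendants≤1 : ∀ i → activePendants i ≤ 1
    activePendants≤1 i = count-≤1 _ unique
      where
      unique : ∀ a b → not (u i a ≡ᵇ 0) ≡ true → not (u i b ≡ᵇ 0) ≡ true → a ≡ b
      unique a b a-active b-active with a Fin.≟ b
      ... | yes a≡b = a≡b
      ... | no  a≢b = contradiction (activePendant-last i a b a≢b (nonzero⇒active a-active))
                                    (<-asym (activePendant-last i b a (a≢b ∘ sym) (nonzero⇒active b-active)))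

    pendantsBefore+active≤p : ∀ s i → pendantsBefore s i + activePendants i ≤ p
    pendantsBefore+active≤p s i = begin
      pendantsBefore s i + activePendants i ≤⟨ +-monoˡ-≤ _ (pendantsBefore-quiet quiet) ⟩
      zeroPendants i + activePendants i     ≡⟨ zero+activePendants i ⟩
      p                                     ∎
      where
      open ≤-Reasoning
      quiet : PendantsQuietBefore i (t s i)
      quiet j uⱼ<tₛ = n≯0⇒n≡0 (λ uⱼ>0 → <-asym uⱼ<tₛ (pendantAfter s i j uⱼ>0))

    activeCyc-lower : ∀ s i → 0 < t s i → 1 + activePendants i ≤ lowerNeighbours (t s) i
    activeCyc-lower s i pos = +-cancelˡ-≤ p _ _ (begin
      p + (1 + activePendants i)                           ≡⟨ trans (sym (+-assoc p 1 _)) (cong (_+ activePendants i) (sym k≡p+1)) ⟩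
      k + activePendants i                                 ≤⟨ +-monoˡ-≤ _ (cyc-valid s i pos) ⟩
      pendantsBefore s i + lowerNeighbours (t s) i + activePendants i ≡⟨ xy∙z≈xz∙y (pendantsBefore s i) _ _ ⟩
      pendantsBefore s i + activePendants i + lowerNeighbours (t s) i ≤⟨ +-monoˡ-≤ _ (pendantsBefore+active≤p s i) ⟩
      p + lowerNeighbours (t s) i                          ∎)
      where open ≤-Reasoning

    activeOrSeed : ∀ s i → 1 + activePendants i ≤ lowerNeighbours (t s) i + 2 * δ₀ (t s i)
    activeOrSeed s i with zero⊎active (t s i)
    ... | inj₁ tᵢ≡0 = subst (λ x → 1 + activePendants i ≤ lowerNeighbours (t s) i + 2 * δ₀ x) (sym tᵢ≡0)
                            (≤-trans (s≤s (activePendants≤1 i)) (m≤n+m 2 _))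
    ... | inj₂ tᵢ>0 = ≤-trans (activeCyc-lower s i tᵢ>0) (m≤m+n _ _)

    activePendants≤2zeros : ∀ s → sum activePendants ≤ 2 * sum (δ₀ ∘ t s)
    activePendants≤2zeros s = +-cancelˡ-≤ n _ _ (begin
      n + sum activePendants              ≡⟨ cong (_+ sum activePendants) (count-true n) ⟨
      sum {n} (λ _ → 1) + sum activePendants ≡⟨ ∑-distrib-+ (λ _ → 1) activePendants ⟨
      sum (λ i → 1 + activePendants i)    ≤⟨ sum≤cycle+ (t s) _ (λ i → 2 * δ₀ (t s i)) (activeOrSeed s) ⟩
      n + sum (λ i → 2 * δ₀ (t s i))      ≡⟨ cong (n +_) (sum-scaleˡ 2 (δ₀ ∘ t s)) ⟩
      n + 2 * sum (δ₀ ∘ t s)              ∎)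
      where open ≤-Reasoning

    lowerBound-p+1 : p * n ≤ kindZeros T
    lowerBound-p+1 = begin
      p * n                                          ≡⟨ trans (*-comm p n) (sym (sum-const n p)) ⟩
      sum {n} (λ _ → p)                              ≡⟨ sum-cong-≗ zero+activePendants ⟨
      sum (λ i → zeroPendants i + activePendants i)  ≡⟨ ∑-distrib-+ zeroPendants activePendants ⟩
      sum zeroPendants + sum activePendants          ≤⟨ +-monoʳ-≤ (sum zeroPendants) active≤zeros ⟩
      sum zeroPendants + (sum (δ₀ ∘ t left) + sum (δ₀ ∘ t right)) ≡⟨ +-comm (sum zeroPendants) _ ⟩
      kindZeros T                                    ∎
      where
      open ≤-Reasoning
      active≤zeros : sum activePendants ≤ sum (δ₀ ∘ t left) + sum (δ₀ ∘ t right)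
      active≤zeros = *-cancelˡ-≤ 2 (begin
        2 * sum activePendants                       ≡⟨ cong (sum activePendants +_) (+-identityʳ _) ⟩
        sum activePendants + sum activePendants      ≤⟨ +-mono-≤ (activePendants≤2zeros left) (activePendants≤2zeros right) ⟩
        2 * sum (δ₀ ∘ t left) + 2 * sum (δ₀ ∘ t right) ≡⟨ *-distribˡ-+ 2 (sum (δ₀ ∘ t left)) (sum (δ₀ ∘ t right)) ⟨
        2 * (sum (δ₀ ∘ t left) + sum (δ₀ ∘ t right)) ∎)

  member : Fin n → Fin (2 + p) → ℕ
  member i zero          = t left i
  member i (suc zero)    = t right i
  member i (suc (suc j)) = u i j

  record FirstActive (i : Fin n) (x : Fin (2 + p)) : Set where
    constructor firstActive-of
    field
      active : 0 < member i x
      first  : ∀ y → 0 < member i y → member i x ≤ member i y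

  firstActive : ∀ i → (∀ x → member i x ≡ 0) ⊎ ∃[ x ] FirstActive i x
  firstActive i with any? (λ x → 0 <? member i x)
  ... | no  none = inj₁ (λ x → n≯0⇒n≡0 (λ pos → none (x , pos)))
  ... | yes some with argmin (λ x → 0 <? member i x) (member i) some
  ...   | x , active , first = inj₂ (x , firstActive-of active first)

  beforeFirst-inactive : ∀ {i x} → FirstActive i x → ∀ y → member i y < member i x → member i y ≡ 0
  beforeFirst-inactive (firstActive-of _ first) y y<x = n≯0⇒n≡0 (λ pos → <⇒≱ y<x (first y pos))

  sideIdx : Side → Fin (2 + p)
  sideIdx left  = zero
  sideIdx right = suc zero

  record SideFirst (i : Fin n) (s : Side) : Set where
    field
      active      : 0 < t s i
      quiet       : PendantsQuietBefore i (t s i)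
      beforeOther : 0 < t (flip s) i → t s i ≤ t (flip s) i

  sideFirst : ∀ {i} s → FirstActive i (sideIdx s) → SideFirst i s
  sideFirst left  fa@(firstActive-of pos first) = record
    { active = pos ; quiet = λ j → beforeFirst-inactive fa (suc (suc j)) ; beforeOther = first (suc zero) }
  sideFirst right fa@(firstActive-of pos first) = record
    { active = pos ; quiet = λ j → beforeFirst-inactive fa (suc (suc j)) ; beforeOther = first zero }

  data GroupStart (i : Fin n) : Set where
    allInactive  : (∀ x → member i x ≡ 0) → GroupStart i
    pendantFirst : ∀ a → FirstActive i (suc (suc a)) → GroupStart i
    sideStarts   : ∀ s → SideFirst i s → GroupStart i

  groupStart : ∀ i → GroupStart i
  groupStart i with firstActive i
  ... | inj₁ inactive           = allInactive inactive
  ... | inj₂ (zero , fa)        = sideStarts left (sideFirst left fa)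
  ... | inj₂ (suc zero , fa)    = sideStarts right (sideFirst right fa)
  ... | inj₂ (suc (suc a) , fa) = pendantFirst a fa

  groupZeros-inactive : ∀ i → (∀ x → member i x ≡ 0) → p ≤ groupZeros i
  groupZeros-inactive i inactive =
    ≤-trans (≤-reflexive (trans (sym (count-true p)) (sum-cong-≗ (λ j → cong δ₀ (sym (inactive (suc (suc j))))))))
            (m≤n+m (zeroPendants i) _)

  pendantFirst-bound : ∀ i a → FirstActive i (suc (suc a)) → k ≤ groupZeros i
  pendantFirst-bound i a fa = begin
    k                                    ≤⟨ pend-valid i a (FirstActive.active fa) ⟩
    cliqueBefore i a + sidesBefore i a   ≤⟨ +-mono-≤ (cliqueBefore-quiet (λ j → beforeFirst-inactive fa (suc (suc j))))
                                                     (+-mono-≤ (iverson-before-inactive (beforeFirst-inactive fa zero))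
                                                               (iverson-before-inactive (beforeFirst-inactive fa (suc zero)))) ⟩
    zeroPendants i + (δ₀ (t left i) + δ₀ (t right i)) ≡⟨ +-comm (zeroPendants i) _ ⟩
    groupZeros i                         ∎
    where open ≤-Reasoning

  sideFirst-bound : ∀ i s → SideFirst i s → k ≤ zeroPendants i + lowerNeighbours (t s) i
  sideFirst-bound i s sf = ≤-trans (cyc-valid s i active) (+-monoˡ-≤ _ (pendantsBefore-quiet quiet))
    where open SideFirst sf

  groupZeros-side : ∀ s i → groupZeros i ≡ δ₀ (t s i) + δ₀ (t (flip s) i) + zeroPendants i
  groupZeros-side left  i = refl
  groupZeros-side right i = cong (_+ zeroPendants i) (+-comm (δ₀ (t left i)) _)

  module _ (k≤p : k ≤ p) where

    k≤groupZeros+2 : ∀ i → k ≤ groupZeros i + 2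
    k≤groupZeros+2 i with groupStart i
    ... | allInactive inactive = ≤-trans k≤p (≤-trans (groupZeros-inactive i inactive) (m≤m+n _ 2))
    ... | pendantFirst a fa    = ≤-trans (pendantFirst-bound i a fa) (m≤m+n _ 2)
    ... | sideStarts s sf      = ≤-trans (sideFirst-bound i s sf) (+-mono-≤ (m≤n+m (zeroPendants i) _) (lowerNeighbours≤2 s i))

    Peak : Fin n → Set
    Peak i = ∀ s → t s (next i) < t s i × t s (prev i) < t s i

    peakSides : ∀ i → groupZeros i + 2 ≡ k →
                ∃[ a ] PendantsQuietBefore i (u i a) × (∀ s → 0 < t s i × t s i < u i a)
    peakSides i gz+2≡k with firstActivePendant i zp<p
      where
      zp<p : zeroPendants i < p
      zp<p = begin-strict
        zeroPendants i     ≤⟨ m≤n+m (zeroPendants i) _ ⟩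
        groupZeros i       <⟨ m<m+n (groupZeros i) z<s ⟩
        groupZeros i + 2   ≡⟨ gz+2≡k ⟩
        k                  ≤⟨ k≤p ⟩
        p                  ∎
        where open ≤-Reasoning
    ... | a , active , quiet = a , quiet , sides
      where
      zeros+2≤sides : δ₀ (t left i) + δ₀ (t right i) + 2 ≤ sidesBefore i a
      zeros+2≤sides = +-cancelˡ-≤ (zeroPendants i) _ _ (begin
        zeroPendants i + (δ₀ (t left i) + δ₀ (t right i) + 2) ≡⟨ x∙yz≈yx∙z (zeroPendants i) _ 2 ⟩
        groupZeros i + 2                                       ≡⟨ gz+2≡k ⟩
        k                                                      ≤⟨ pend-valid i a active ⟩
        cliqueBefore i a + sidesBefore i a                     ≤⟨ +-monoˡ-≤ _ (cliqueBefore-quiet quiet) ⟩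
        zeroPendants i + sidesBefore i a                       ∎)
        where open ≤-Reasoning
      zeros≡0 : δ₀ (t left i) + δ₀ (t right i) ≡ 0
      zeros≡0 = n≤0⇒n≡0 (+-cancelʳ-≤ 2 _ 0 (≤-trans zeros+2≤sides (sidesBefore≤2 i a)))
      before = iverson-both (t left i <ᵇ u i a) (t right i <ᵇ u i a) (≤-trans (m≤n+m 2 _) zeros+2≤sides)
      sides : ∀ s → 0 < t s i × t s i < u i a
      sides left  = δ₀≡0⇒active (m+n≡0⇒m≡0 _ zeros≡0) , <ᵇ-sound (proj₁ before)
      sides right = δ₀≡0⇒active (m+n≡0⇒n≡0 (δ₀ (t left i)) zeros≡0) , <ᵇ-sound (proj₂ before)

    bothLower : ∀ i → groupZeros i + 2 ≡ k → ∀ s → 2 ≤ lowerNeighbours (t s) i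
    bothLower i gz+2≡k s with peakSides i gz+2≡k
    ... | a , quiet , sides = +-cancelˡ-≤ (zeroPendants i) 2 _ (begin
      zeroPendants i + 2                           ≤⟨ +-monoˡ-≤ 2 (m≤n+m (zeroPendants i) _) ⟩
      groupZeros i + 2                             ≡⟨ gz+2≡k ⟩
      k                                            ≤⟨ cyc-valid s i (proj₁ (sides s)) ⟩
      pendantsBefore s i + lowerNeighbours (t s) i ≤⟨ +-monoˡ-≤ _ (pendantsBefore-quiet quietₛ) ⟩
      zeroPendants i + lowerNeighbours (t s) i     ∎)
      where
      open ≤-Reasoning
      quietₛ : PendantsQuietBefore i (t s i)
      quietₛ j uⱼ<tₛ = quiet j (<-trans uⱼ<tₛ (proj₂ (sides s)))

    peak : ∀ i → groupZeros i + 2 ≡ k → Peak i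
    peak i gz+2≡k s with iverson-both (t s (next i) <ᵇ t s i) (t s (prev i) <ᵇ t s i) (bothLower i gz+2≡k s)
    ... | next<i , prev<i = <ᵇ-sound next<i , <ᵇ-sound prev<i

    record Leader (i : Fin n) (s : Side) : Set where
      field
        first : SideFirst i s
        slack : 1 + δ₀ (t (flip s) i) ≤ lowerNeighbours (t s) i

    leader : ∀ i → groupZeros i + 1 ≡ k → ∃[ s ] Leader i s
    leader i gz+1≡k with groupStart i
    ... | allInactive inactive = contradiction (≤-trans k≤p (groupZeros-inactive i inactive)) (<⇒≱ (≤-reflexive (trans (+-comm 1 _) gz+1≡k)))
    ... | pendantFirst a fa    = contradiction (pendantFirst-bound i a fa) (<⇒≱ (≤-reflexive (trans (+-comm 1 _) gz+1≡k)))
    ... | sideStarts s sf      = s , record { first = sf ; slack = +-cancelˡ-≤ (zeroPendants i) _ _ (begin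
      zeroPendants i + (1 + δ₀ (t (flip s) i))              ≡⟨ trans (+-comm (zeroPendants i) _) (+-comm 1 (δ₀ (t (flip s) i) + zeroPendants i)) ⟩
      0 + δ₀ (t (flip s) i) + zeroPendants i + 1            ≡⟨ cong (λ x → x + δ₀ (t (flip s) i) + zeroPendants i + 1) (δ₀-pos (SideFirst.active sf)) ⟨
      δ₀ (t s i) + δ₀ (t (flip s) i) + zeroPendants i + 1   ≡⟨ cong (_+ 1) (groupZeros-side s i) ⟨
      groupZeros i + 1                                      ≡⟨ gz+1≡k ⟩
      k                                                     ≤⟨ sideFirst-bound i s sf ⟩
      zeroPendants i + lowerNeighbours (t s) i              ∎) }
      where open ≤-Reasoning

    noAdjacentPeaks : ∀ i → Peak i → Peak (next i) → ⊥
    noAdjacentPeaks i peakᵢ peakⱼ =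
      <-asym (proj₁ (peakᵢ left)) (subst (λ x → t left x < t left (next i)) (prev-next i) (proj₂ (peakⱼ left)))

    descendsForward : ∀ {i s} → Leader (next i) s → t s (next i) < t s i →
                      t s (next (next i)) < t s (next i) × 0 < t (flip s) (next i)
    descendsForward {i} {s} ldr j<i with lower-via-next (t s) (next i) (Leader.slack ldr) (<⇒≤ (subst (λ x → t s (next i) < t s x) (sym (prev-next i)) j<i))
    ... | l<j , δ≡0 = l<j , δ₀≡0⇒active δ≡0

    descendsBackward : ∀ {i s} → Leader i s → t s i < t s (next i) → t s (prev i) < t s i × 0 < t (flip s) i
    descendsBackward {i} {s} ldr i<next with lower-via-prev (t s) i (Leader.slack ldr) (<⇒≤ i<next)
    ... | prev<i , δ≡0 = prev<i , δ₀≡0⇒active δ≡0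

    noPeakLeaderPeak : ∀ i s → Peak i → Leader (next i) s → Peak (next (next i)) → ⊥
    noPeakLeaderPeak i s peakᵢ ldr peakₗ =
      <-asym (proj₁ (descendsForward ldr (proj₁ (peakᵢ s))))
             (subst (λ x → t s x < t s (next (next i))) (prev-next (next i)) (proj₂ (peakₗ s)))

    noPeakLeaderLeaderPeak : ∀ i s s′ → Peak i → Leader (next i) s → Leader (next (next i)) s′ →
                             Peak (next (next (next i))) → ⊥
    noPeakLeaderLeaderPeak i s s′ peakᵢ ldrⱼ ldrₗ peak_q
      with descendsForward ldrⱼ (proj₁ (peakᵢ s))
         | descendsBackward ldrₗ (subst (λ x → t s′ x < t s′ (next l)) (prev-next l) (proj₂ (peak_q s′)))
         | sameOrFlipped s s′
      where
      j = next i
      l = next j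
    ... | l<j , _ | j<l , _ | inj₁ refl = <-asym l<j (subst (λ x → t s x < t s (next (next i))) (prev-next (next i)) j<l)
    ... | l<j , flipⱼ-active | j<l , flipₗ-active | inj₂ refl = <-irrefl refl (begin-strict
      t s (next i)                ≤⟨ SideFirst.beforeOther (Leader.first ldrⱼ) flipⱼ-active ⟩
      t (flip s) (next i)         ≡⟨ cong (t (flip s)) (prev-next (next i)) ⟨
      t (flip s) (prev (next (next i))) <⟨ j<l ⟩
      t (flip s) (next (next i))  ≤⟨ subst (λ s″ → t (flip s) (next (next i)) ≤ t s″ (next (next i))) (flip-involutive s)
                                            (SideFirst.beforeOther (Leader.first ldrₗ) flipₗ-active) ⟩
      t s (next (next i))         <⟨ l<j ⟩
      t s (next i)                ∎)
      where open ≤-Reasoning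

    -- By k≤groupZeros+2 the truncated subtraction loses nothing.
    excess : Fin n → ℕ
    excess i = groupZeros i + 2 ∸ k

    excess+k : ∀ i → excess i + k ≡ groupZeros i + 2
    excess+k i = m∸n+n≡m (k≤groupZeros+2 i)

    peak-excess : ∀ i → excess i ≡ 0 → Peak i
    peak-excess i e≡0 = peak i (trans (sym (excess+k i)) (cong (_+ k) e≡0))

    leader-excess : ∀ i → excess i ≡ 1 → ∃[ s ] Leader i s
    leader-excess i e≡1 = leader i (suc-injective (trans (sym (+-suc (groupZeros i) 1)) (trans (sym (excess+k i)) (cong (_+ k) e≡1))))

    excess-sparse : SparseZeros excess
    excess-sparse = record
      { no-00   = λ i e₀ e₁ → noAdjacentPeaks i (peak-excess i e₀) (peak-excess (next i) e₁)
      ; no-010  = λ i e₀ e₁ e₂ → noPeakLeaderPeak i _ (peak-excess i e₀) (proj₂ (leader-excess (next i) e₁)) (peak-excess _ e₂)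
      ; no-0110 = λ i e₀ e₁ e₂ e₃ → noPeakLeaderLeaderPeak i _ _ (peak-excess i e₀) (proj₂ (leader-excess (next i) e₁))
                                                              (proj₂ (leader-excess (next (next i)) e₂)) (peak-excess _ e₃)
      }

    lowerBound-≤p : 2 ≤ k → (k ∸ 2) * n + (3 * n + 3) / 4 ≤ kindZeros T
    lowerBound-≤p 2≤k = begin
      (k ∸ 2) * n + (3 * n + 3) / 4   ≤⟨ +-monoʳ-≤ ((k ∸ 2) * n) (sparseZeros-sum excess-sparse) ⟩
      (k ∸ 2) * n + sum excess        ≡⟨ +-comm ((k ∸ 2) * n) (sum excess) ⟩
      sum excess + (k ∸ 2) * n        ≡⟨ cong (sum excess +_) (trans (sum-const n (k ∸ 2)) (*-comm n (k ∸ 2))) ⟨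
      sum excess + sum {n} (λ _ → k ∸ 2) ≡⟨ ∑-distrib-+ excess (λ _ → k ∸ 2) ⟨
      sum (λ i → excess i + (k ∸ 2))  ≡⟨ sum-cong-≗ groupZeros≡ ⟩
      sum groupZeros                  ≡⟨ kindZeros≡sum ⟨
      kindZeros T                     ∎
      where
      open ≤-Reasoning
      groupZeros≡ : ∀ i → excess i + (k ∸ 2) ≡ groupZeros i
      groupZeros≡ i = +-cancelʳ-≡ 2 _ _ (begin-equality
        excess i + (k ∸ 2) + 2   ≡⟨ +-assoc (excess i) (k ∸ 2) 2 ⟩
        excess i + (k ∸ 2 + 2)   ≡⟨ cong (excess i +_) (m∸n+n≡m 2≤k) ⟩
        excess i + k             ≡⟨ excess+k i ⟩
        groupZeros i + 2         ∎)

-- Upper bounds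

even : ℕ → Bool
even zero          = true
even (suc zero)    = false
even (suc (suc a)) = even a

even-suc : ∀ a → even (suc a) ≡ not (even a)
even-suc zero          = refl
even-suc (suc zero)    = refl
even-suc (suc (suc a)) = even-suc a

count-even : ∀ n → count {n} (even ∘ toℕ) ≡ ⌈ n /2⌉
count-even zero          = refl
count-even (suc zero)    = refl
count-even (suc (suc n)) = cong suc (count-even n)

odd⇒next-even : ∀ {m} (i : Fin (suc m)) → even (toℕ i) ≡ false → even (toℕ (next i)) ≡ true
odd⇒next-even {m} i odd with toℕ i ≟ m
... | yes i≡m = cong (even ∘ toℕ) (next-last i i≡m)
... | no  i≢m = trans (cong even (toℕ-next i i≢m)) (trans (even-suc (toℕ i)) (cong not odd))

odd⇒prev-even : ∀ {m} (i : Fin (suc m)) → even (toℕ i) ≡ false → even (toℕ (prev i)) ≡ true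
odd⇒prev-even (suc i) odd with even (toℕ i) in e
... | true  = trans (cong even (toℕ-inject₁ i)) e
... | false = contradiction (trans (sym odd) (trans (even-suc (toℕ i)) (cong not e))) λ ()

even⇒next-odd : ∀ {m} (i : Fin (suc m)) → even (toℕ i) ≡ true → toℕ i ≢ m → even (toℕ (next i)) ≡ false
even⇒next-odd i ev i≢m = trans (cong even (toℕ-next i i≢m)) (trans (even-suc (toℕ i)) (cong not ev))

even⇒prev-odd : ∀ {m} (i : Fin (suc m)) → even (toℕ i) ≡ true → toℕ i ≢ 0 → even (toℕ (prev i)) ≡ false
even⇒prev-odd zero    _  i≢0 = contradiction refl i≢0
even⇒prev-odd (suc i) ev _ with even (toℕ i) in e
... | false = trans (cong even (toℕ-inject₁ i)) e
... | true  = contradiction (trans (sym ev) (trans (even-suc (toℕ i)) (cong not e))) λ ()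

staggered : ∀ {p} → ℕ → ℕ → Fin p → ℕ
staggered z late j = if toℕ j <ᵇ z then 0 else late

staggered-zeros : ∀ {p z late} → z ≤ p → 0 < late → count {p} (λ j → staggered z late j ≡ᵇ 0) ≡ z
staggered-zeros {p} {z} {suc late} z≤p _ = trans (sum-cong-≗ {p} (λ j → zero-iff (toℕ j <ᵇ z))) (count-toℕ< p z z≤p)
  where
  zero-iff : ∀ b → iverson ((if b then 0 else suc late) ≡ᵇ 0) ≡ iverson b
  zero-iff true  = refl
  zero-iff false = refl

staggered-active : ∀ {p z late} {a : Fin p} → 0 < staggered z late a → staggered z late a ≡ late
staggered-active {z = z} {a = a} pos with toℕ a <ᵇ z
... | false = refl

staggered-before : ∀ {p z late τ} → z ≤ p → 0 < τ → z ≤ count {p} (λ j → staggered z late j <ᵇ τ)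
staggered-before {p} {z} {late} {τ} z≤p τ>0 = begin
  z                                        ≡⟨ count-toℕ< p z z≤p ⟨
  count {p} (λ j → toℕ j <ᵇ z)             ≤⟨ count-mono early⇒before ⟩
  count {p} (λ j → staggered z late j <ᵇ τ) ∎
  where
  open ≤-Reasoning
  early⇒before : ∀ (j : Fin p) → (toℕ j <ᵇ z) ≡ true → (staggered z late j <ᵇ τ) ≡ true
  early⇒before j early rewrite early = <ᵇ-true τ>0

staggered-allBefore : ∀ {p z late τ} → late < τ → count {p} (λ j → staggered z late j <ᵇ τ) ≡ p
staggered-allBefore {p} {z} {late} {τ} late<τ = trans (sum-cong-≗ {p} before) (count-true p)
  where
  before : ∀ j → iverson (staggered z late j <ᵇ τ) ≡ 1
  before j with toℕ j <ᵇ z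
  ... | true  = iverson-< (≤-trans (s≤s z≤n) late<τ)
  ... | false = iverson-< late<τ

staggered-clique : ∀ {p z late} → z ≤ p → (a : Fin p) → 0 < staggered z late a →
                   z ≤ count (λ b → not (a =ᶠ b) ∧ (staggered z late b <ᵇ staggered z late a))
staggered-clique {p} {z} {late} z≤p a pos with toℕ a <ᵇ z in a-late
... | false = begin
  z                                        ≡⟨ count-toℕ< p z z≤p ⟨
  count {p} (λ b → toℕ b <ᵇ z)             ≤⟨ count-mono early⇒before ⟩
  count (λ b → not (a =ᶠ b) ∧ (staggered z late b <ᵇ late)) ∎
  where
  open ≤-Reasoning
  a≢b : ∀ b → (toℕ b <ᵇ z) ≡ true → a ≢ b
  a≢b b early refl = contradiction (trans (sym a-late) early) λ ()
  early⇒before : ∀ b → (toℕ b <ᵇ z) ≡ true → (not (a =ᶠ b) ∧ (staggered z late b <ᵇ late)) ≡ true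
  early⇒before b early rewrite early | =ᶠ-≢ (a≢b b early) = <ᵇ-true pos

earlierBy : ∀ {x τ} → x < τ → 1 ≤ iverson (x <ᵇ τ)
earlierBy x<τ = ≤-reflexive (sym (iverson-< x<τ))

module StaggeredSchedule (m p : ℕ) {Role : Set} (role : Fin (suc m) → Role)
                         (leftTime rightTime zeroCount late : Role → ℕ) where

  open DoubleCorona m p

  schedule : Kind n p → ℕ
  schedule (vK i)   = leftTime (role i)
  schedule (wK i)   = rightTime (role i)
  schedule (uK i j) = staggered (zeroCount (role i)) (late (role i)) j

  groupZeros : Role → ℕ
  groupZeros r = δ₀ (leftTime r) + δ₀ (rightTime r) + zeroCount r

  kindZeros-schedule : (∀ r → zeroCount r ≤ p) → (∀ r → 0 < late r) → kindZeros schedule ≡ sum (groupZeros ∘ role)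
  kindZeros-schedule zeroCount≤p late>0 = begin
    kindZeros schedule                             ≡⟨ cong (sum L + sum R +_) (sum-cong-≗ pendantZeros) ⟩
    sum L + sum R + sum (zeroCount ∘ role)         ≡⟨ cong (_+ sum (zeroCount ∘ role)) (∑-distrib-+ L R) ⟨
    sum (λ i → L i + R i) + sum (zeroCount ∘ role) ≡⟨ ∑-distrib-+ (λ i → L i + R i) (zeroCount ∘ role) ⟨
    sum (groupZeros ∘ role)                        ∎
    where
    open ≡-Reasoning
    L R : Fin n → ℕ
    L = δ₀ ∘ leftTime ∘ role
    R = δ₀ ∘ rightTime ∘ role
    pendantZeros : ∀ i → count (λ j → schedule (uK i j) ≡ᵇ 0) ≡ zeroCount (role i)
    pendantZeros i = staggered-zeros {late = late (role i)} (zeroCount≤p (role i)) (late>0 (role i))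

  beforeActivePendant : ∀ r {a : Fin p} → 0 < staggered (zeroCount r) (late r) a → ∀ {x} → x < late r →
                        1 ≤ iverson (x <ᵇ staggered (zeroCount r) (late r) a)
  beforeActivePendant r {a} pos x<late =
    earlierBy (subst (_ <_) (sym (staggered-active {z = zeroCount r} {late = late r} {a = a} pos)) x<late)

module AlternatingConstruction (m p : ℕ) where

  open DoubleCorona m p

  parityTime : Fin n → ℕ
  parityTime i = if even (toℕ i) then 0 else 1

  alternating : Kind n p → ℕ
  alternating (vK i)   = parityTime i
  alternating (wK i)   = parityTime i
  alternating (uK _ _) = 0

  alternating-valid : ∀ {k} → k ≡ p + 2 → IsLocalSchedule k alternating
  alternating-valid {k} k≡p+2 = record
    { cyc-ok  = λ { left i → cycle-ok i ; right i → cycle-ok i }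
    ; pend-ok = λ _ _ ()
    }
    where
    cycle-ok : ∀ i → 0 < parityTime i → k ≤ count {p} (λ _ → 0 <ᵇ parityTime i)
                                          + (iverson (parityTime (next i) <ᵇ parityTime i) + iverson (parityTime (prev i) <ᵇ parityTime i))
    cycle-ok i pos with even (toℕ i) in odd
    ... | false rewrite odd⇒next-even i odd | odd⇒prev-even i odd = ≤-reflexive (trans k≡p+2 (cong (_+ 2) (sym (count-true p))))

  alternating-zeros : kindZeros alternating ≡ p * n + 2 * ⌈ n /2⌉
  alternating-zeros = begin
    kindZeros alternating                              ≡⟨ cong₂ _+_ (cong₂ _+_ evens evens) (trans (sum-cong-≗ {n} (λ _ → count-true p)) (sum-const n p)) ⟩
    ⌈ n /2⌉ + ⌈ n /2⌉ + n * p                          ≡⟨ rearrange ⌈ n /2⌉ n p ⟩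
    p * n + 2 * ⌈ n /2⌉                                ∎
    where
    open ≡-Reasoning
    rearrange : ∀ h n p → h + h + n * p ≡ p * n + 2 * h
    rearrange = solve-∀
    evens : sum (δ₀ ∘ parityTime) ≡ ⌈ n /2⌉
    evens = trans (sum-cong-≗ {n} (λ i → zero-iff-even (even (toℕ i)))) (count-even n)
      where
      zero-iff-even : ∀ b → δ₀ (if b then 0 else 1) ≡ iverson b
      zero-iff-even true  = refl
      zero-iff-even false = refl

module SeedConstruction (m p : ℕ) (2≤m : 2 ≤ m) (1≤p : 1 ≤ p) where

  open DoubleCorona m p

  data Seed : Set where
    seedLeft seedRight seedPendants : Seed

  seed : Fin n → Seed
  seed i = if even (toℕ i) then (if toℕ i ≡ᵇ m then seedPendants else seedLeft) else seedRight

  leftTime rightTime zeroCount : Seed → ℕ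
  leftTime seedLeft     = 0
  leftTime seedRight    = 2
  leftTime seedPendants = 1
  rightTime seedLeft     = 2
  rightTime seedRight    = 0
  rightTime seedPendants = 1
  zeroCount seedPendants = p
  zeroCount _            = p ∸ 1

  open StaggeredSchedule m p seed leftTime rightTime zeroCount (λ _ → 3) public renaming (schedule to seeded)

  data SeedView (i : Fin n) : Seed → Set where
    left-seeded  : even (toℕ i) ≡ true → toℕ i ≢ m → SeedView i seedLeft
    right-seeded : even (toℕ i) ≡ false → SeedView i seedRight
    pend-seeded  : even (toℕ i) ≡ true → toℕ i ≡ m → SeedView i seedPendants

  seedView : ∀ i → SeedView i (seed i)
  seedView i with even (toℕ i) in ev | toℕ i ≟ m
  ... | false | _       = right-seeded ev
  ... | true  | yes i≡m rewrite ≡ᵇ-true i≡m = pend-seeded ev i≡m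
  ... | true  | no  i≢m rewrite ≡ᵇ-false i≢m = left-seeded ev i≢m

  even⇒leftTime≤1 : ∀ i → even (toℕ i) ≡ true → leftTime (seed i) ≤ 1
  even⇒leftTime≤1 i ev with seed i | seedView i
  ... | _ | left-seeded _ _  = z≤n
  ... | _ | right-seeded od  = contradiction (trans (sym ev) od) λ ()
  ... | _ | pend-seeded _ _  = ≤-refl

  odd⇒rightTime≡0 : ∀ i → even (toℕ i) ≡ false → rightTime (seed i) ≡ 0
  odd⇒rightTime≡0 i od with seed i | seedView i
  ... | _ | left-seeded ev _ = contradiction (trans (sym ev) od) λ ()
  ... | _ | right-seeded _   = refl
  ... | _ | pend-seeded ev _ = contradiction (trans (sym ev) od) λ ()

  last⇒rightTime≤1 : ∀ i → toℕ i ≡ m → rightTime (seed i) ≤ 1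
  last⇒rightTime≤1 i i≡m with seed i | seedView i
  ... | _ | left-seeded _ i≢m = contradiction i≡m i≢m
  ... | _ | right-seeded _    = z≤n
  ... | _ | pend-seeded _ _   = ≤-refl

  zeroCount≥ : ∀ s → p ∸ 1 ≤ zeroCount s
  zeroCount≥ seedLeft     = ≤-refl
  zeroCount≥ seedRight    = ≤-refl
  zeroCount≥ seedPendants = m∸n≤m p 1

  zeroCount≤p : ∀ s → zeroCount s ≤ p
  zeroCount≤p seedLeft     = m∸n≤m p 1
  zeroCount≤p seedRight    = m∸n≤m p 1
  zeroCount≤p seedPendants = ≤-refl

  seed-zero : seed zero ≡ seedLeft
  seed-zero with seed zero | seedView zero
  ... | _ | left-seeded _ _    = refl
  ... | _ | right-seeded od    = contradiction od λ ()
  ... | _ | pend-seeded _ 0≡m  = contradiction (subst (2 ≤_) (sym 0≡m) 2≤m) λ ()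

  p+1≡ : p ∸ 1 + 2 ≡ p + 1
  p+1≡ = trans (sym (+-assoc (p ∸ 1) 1 1)) (cong (_+ 1) (m∸n+n≡m 1≤p))

  seeded-cyc-ok : ∀ s i → 0 < seeded (cyc s i) → p + 1 ≤ cycNbrs (λ κ → seeded κ <ᵇ seeded (cyc s i)) s i
  seeded-cyc-ok left i pos with seed i | seedView i
  ... | _ | right-seeded od = ≤-trans (≤-reflexive (sym p+1≡))
        (+-mono-≤ (staggered-before (m∸n≤m p 1) z<s)
                  (+-mono-≤ (earlierBy (s≤s (even⇒leftTime≤1 (next i) (odd⇒next-even i od))))
                            (earlierBy (s≤s (even⇒leftTime≤1 (prev i) (odd⇒prev-even i od))))))
  ... | _ | pend-seeded _ i≡m =
        +-mono-≤ (staggered-before ≤-refl z<s) (≤-trans (earlierBy nextSeeded) (m≤m+n _ _))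
    where
    nextSeeded : leftTime (seed (next i)) < 1
    nextSeeded rewrite next-last i i≡m | seed-zero = z<s
  seeded-cyc-ok right i pos with seed i | seedView i
  ... | _ | left-seeded ev i≢m = ≤-trans (≤-reflexive (sym p+1≡))
        (+-mono-≤ (staggered-before (m∸n≤m p 1) z<s)
                  (+-mono-≤ (earlierBy (s≤s nextTime≤1)) (earlierBy (s≤s prevTime≤1))))
    where
    nextTime≤1 : rightTime (seed (next i)) ≤ 1
    nextTime≤1 = subst (_≤ 1) (sym (odd⇒rightTime≡0 (next i) (even⇒next-odd i ev i≢m))) z≤n
    prevTime≤1 : rightTime (seed (prev i)) ≤ 1
    prevTime≤1 with toℕ i ≟ 0
    ... | yes i≡0 = last⇒rightTime≤1 (prev i) (prev-zero i i≡0)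
      where
      prev-zero : ∀ i → toℕ i ≡ 0 → toℕ (prev i) ≡ m
      prev-zero zero _ = toℕ-fromℕ m
    ... | no  i≢0 = subst (_≤ 1) (sym (odd⇒rightTime≡0 (prev i) (even⇒prev-odd i ev i≢0))) z≤n
  ... | _ | pend-seeded ev i≡m =
        +-mono-≤ (staggered-before ≤-refl z<s) (≤-trans (earlierBy (s≤s prevSeeded)) (m≤n+m _ _))
    where
    i≢0 : toℕ i ≢ 0
    i≢0 i≡0 = contradiction (subst (2 ≤_) (trans (sym i≡m) i≡0) 2≤m) λ ()
    prevSeeded : rightTime (seed (prev i)) ≤ 0
    prevSeeded = ≤-reflexive (odd⇒rightTime≡0 (prev i) (even⇒prev-odd i ev i≢0))

  seeded-pend-ok : ∀ i a → 0 < seeded (uK i a) → p + 1 ≤ pendNbrs (λ κ → seeded κ <ᵇ seeded (uK i a)) i a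
  seeded-pend-ok i a pos = ≤-trans (≤-reflexive (sym p+1≡))
    (+-mono-≤ (≤-trans (zeroCount≥ (seed i)) (staggered-clique (zeroCount≤p (seed i)) a pos))
              (+-mono-≤ (beforeActivePendant (seed i) pos (s≤s (leftTime≤2 (seed i))))
                        (beforeActivePendant (seed i) pos (s≤s (rightTime≤2 (seed i))))))
    where
    leftTime≤2 : ∀ s → leftTime s ≤ 2
    leftTime≤2 seedLeft     = z≤n
    leftTime≤2 seedRight    = ≤-refl
    leftTime≤2 seedPendants = s≤s z≤n
    rightTime≤2 : ∀ s → rightTime s ≤ 2
    rightTime≤2 seedLeft     = ≤-refl
    rightTime≤2 seedRight    = z≤n
    rightTime≤2 seedPendants = s≤s z≤n

  seeded-valid : IsLocalSchedule (p + 1) seeded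
  seeded-valid = record { cyc-ok = seeded-cyc-ok ; pend-ok = seeded-pend-ok }

  seeded-zeros : kindZeros seeded ≡ p * n
  seeded-zeros = begin
    kindZeros seeded        ≡⟨ kindZeros-schedule zeroCount≤p (λ _ → z<s) ⟩
    sum (groupZeros ∘ seed) ≡⟨ sum-cong-≗ (perGroup ∘ seed) ⟩
    sum {n} (λ _ → p)       ≡⟨ trans (sum-const n p) (*-comm n p) ⟩
    p * n                   ∎
    where
    open ≡-Reasoning
    perGroup : ∀ s → groupZeros s ≡ p
    perGroup seedLeft     = trans (+-comm 1 (p ∸ 1)) (m∸n+n≡m 1≤p)
    perGroup seedRight    = trans (+-comm 1 (p ∸ 1)) (m∸n+n≡m 1≤p)
    perGroup seedPendants = refl

data Phase : Set where
  ph0 ph1 ph2 ph3 : Phase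

advance : Phase → Phase
advance ph0 = ph1
advance ph1 = ph2
advance ph2 = ph3
advance ph3 = ph0

phase : ℕ → Phase
phase zero    = ph0
phase (suc a) = advance (phase a)

advance⁴ : ∀ x → advance (advance (advance (advance x))) ≡ x
advance⁴ ph0 = refl
advance⁴ ph1 = refl
advance⁴ ph2 = refl
advance⁴ ph3 = refl

isPh0 : Phase → Bool
isPh0 ph0 = true
isPh0 _   = false

isPh2 : Phase → Bool
isPh2 ph2 = true
isPh2 _   = false

ph2Count : ℕ → ℕ
ph2Count M = count {M} (λ i → isPh2 (phase (toℕ i)))

ph2Count-bound : ∀ M → M ≤ 4 * ph2Count M + 2
ph2Count-bound 0 = z≤n
ph2Count-bound 1 = s≤s z≤n
ph2Count-bound 2 = ≤-refl
ph2Count-bound 3 = s≤s (s≤s (s≤s z≤n))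
ph2Count-bound (suc (suc (suc (suc M)))) = begin
  4 + M                       ≤⟨ +-monoʳ-≤ 4 (ph2Count-bound M) ⟩
  4 + (4 * ph2Count M + 2)    ≡⟨ cong (λ c → 4 + (4 * c + 2)) shifted ⟨
  4 + (4 * c′ + 2)            ≡⟨ trans (cong (_+ 2) (*-suc 4 c′)) (+-assoc 4 (4 * c′) 2) ⟨
  4 * (1 + c′) + 2            ∎
  where
  open ≤-Reasoning
  c′ = count {M} (λ i → isPh2 (advance (advance (advance (advance (phase (toℕ i)))))))
  shifted : c′ ≡ ph2Count M
  shifted = sum-cong-≗ {M} (λ i → cong (iverson ∘ isPh2) (advance⁴ (phase (toℕ i))))

quarter-bound : ∀ n P → n ≤ 4 * P + 3 → n ≤ (3 * n + 3) / 4 + P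
quarter-bound n P n≤ = begin
  n                         ≤⟨ m≤n+m∸n n P ⟩
  P + (n ∸ P)               ≡⟨ +-comm P (n ∸ P) ⟩
  n ∸ P + P                 ≤⟨ +-monoˡ-≤ P (begin
    n ∸ P                   ≡⟨ m*n/n≡m (n ∸ P) 4 ⟨
    (n ∸ P) * 4 / 4         ≤⟨ /-monoˡ-≤ 4 (subst (_≤ 3 * n + 3) (*-comm 4 (n ∸ P)) 4[n∸P]≤) ⟩
    (3 * n + 3) / 4         ∎) ⟩
  (3 * n + 3) / 4 + P       ∎
  where
  open ≤-Reasoning
  4[n∸P]≤ : 4 * (n ∸ P) ≤ 3 * n + 3
  4[n∸P]≤ = begin
    4 * (n ∸ P)             ≡⟨ *-distribˡ-∸ 4 n P ⟩
    4 * n ∸ 4 * P           ≤⟨ m≤n+o⇒m∸n≤o (4 * n) (4 * P) (begin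
      n + 3 * n             ≤⟨ +-monoˡ-≤ (3 * n) n≤ ⟩
      4 * P + 3 + 3 * n     ≡⟨ trans (+-assoc (4 * P) 3 (3 * n)) (cong (4 * P +_) (+-comm 3 (3 * n))) ⟩
      4 * P + (3 * n + 3)   ∎) ⟩
    3 * n + 3               ∎

module PeakPattern (m : ℕ) (2≤m : 2 ≤ m) where

  data Role : Set where
    seedV peak link link′ : Role

  base : Phase → Role
  base ph0 = seedV
  base ph1 = link
  base ph2 = peak
  base ph3 = link

  -- Positions 0, 1, 2, 3 (mod 4) get seedV, link, peak, link; the last position gets link, and
  -- the one before it link′ when m ≡ 0 (mod 4).  So every link is next to a seedV, a link′ is
  -- followed by a link, and a seedV or peak has links on both sides.
  roleℕ : ℕ → Role
  roleℕ a = if a ≡ᵇ m then link else if (suc a ≡ᵇ m) ∧ isPh0 (phase m) then link′ else base (phase a)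

  data RoleView (a : ℕ) : Role → Set where
    at-end     : a ≡ m → RoleView a link
    before-end : suc a ≡ m → phase m ≡ ph0 → RoleView a link′
    regular    : a ≢ m → (suc a ≡ m → phase m ≢ ph0) → RoleView a (base (phase a))

  roleView : ∀ a → RoleView a (roleℕ a)
  roleView a with a ≟ m
  ... | yes a≡m rewrite ≡ᵇ-true a≡m = at-end a≡m
  ... | no  a≢m rewrite ≡ᵇ-false a≢m with suc a ≟ m | phase m in ph-m
  ...   | yes a+1≡m | ph0 rewrite ≡ᵇ-true a+1≡m = before-end a+1≡m ph-m
  ...   | yes a+1≡m | ph1 rewrite ≡ᵇ-true a+1≡m = regular a≢m (λ _ m-ph0 → contradiction (trans (sym ph-m) m-ph0) λ ())
  ...   | yes a+1≡m | ph2 rewrite ≡ᵇ-true a+1≡m = regular a≢m (λ _ m-ph0 → contradiction (trans (sym ph-m) m-ph0) λ ())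
  ...   | yes a+1≡m | ph3 rewrite ≡ᵇ-true a+1≡m = regular a≢m (λ _ m-ph0 → contradiction (trans (sym ph-m) m-ph0) λ ())
  ...   | no  a+1≢m | _   rewrite ≡ᵇ-false a+1≢m = regular a≢m (λ a+1≡m → contradiction a+1≡m a+1≢m)

  data IsLink : Role → Set where
    isLink  : IsLink link
    isLink′ : IsLink link′

  oddPhase⇒link : ∀ b → phase b ≡ ph1 ⊎ phase b ≡ ph3 → IsLink (roleℕ b)
  oddPhase⇒link b odd with roleℕ b | roleView b
  ... | _ | at-end _       = isLink
  ... | _ | before-end _ _ = isLink′
  ... | _ | regular _ _ with phase b | odd
  ...   | ph1 | _ = isLink
  ...   | ph3 | _ = isLink
  ...   | ph0 | inj₁ ()
  ...   | ph0 | inj₂ ()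
  ...   | ph2 | inj₁ ()
  ...   | ph2 | inj₂ ()

  roleℕ-m : roleℕ m ≡ link
  roleℕ-m rewrite ≡ᵇ-true {m} refl = refl

  roleℕ-0 : roleℕ 0 ≡ seedV
  roleℕ-0 with roleℕ 0 | roleView 0
  ... | _ | at-end 0≡m         = contradiction (subst (2 ≤_) (sym 0≡m) 2≤m) λ ()
  ... | _ | before-end 1≡m _   = contradiction (subst (2 ≤_) (sym 1≡m) 2≤m) λ { (s≤s ()) }
  ... | _ | regular _ _        = refl

  role : Fin (suc m) → Role
  role i = roleℕ (toℕ i)

  data Context (i : Fin (suc m)) : Role → Set where
    seedContext  : IsLink (role (next i)) → IsLink (role (prev i)) → Context i seedV
    peakContext  : IsLink (role (next i)) → IsLink (role (prev i)) → Context i peak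
    linkContext  : role (next i) ≡ seedV ⊎ role (prev i) ≡ seedV → Context i link
    link′Context : role (next i) ≡ link → Context i link′

  seedAt : ∀ b → phase b ≡ ph0 → b ≢ m → roleℕ b ≡ seedV
  seedAt b ph b≢m with roleℕ b | roleView b
  ... | _ | at-end b≡m          = contradiction b≡m b≢m
  ... | _ | before-end b+1≡m ph-m = contradiction (trans (sym (cong advance ph)) (trans (cong phase b+1≡m) ph-m)) λ ()
  ... | _ | regular _ _         = cong base ph

  predPhase : ∀ x → advance x ≡ ph0 ⊎ advance x ≡ ph2 → x ≡ ph1 ⊎ x ≡ ph3
  predPhase ph1 _ = inj₁ refl
  predPhase ph3 _ = inj₂ refl
  predPhase ph0 (inj₁ ())
  predPhase ph0 (inj₂ ())
  predPhase ph2 (inj₁ ())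
  predPhase ph2 (inj₂ ())

  next-link : ∀ i → toℕ i ≢ m → phase (toℕ i) ≡ ph0 ⊎ phase (toℕ i) ≡ ph2 → IsLink (role (next i))
  next-link i i≢m even = subst (IsLink ∘ roleℕ) (sym (toℕ-next i i≢m)) (oddPhase⇒link _ (odd even))
    where
    odd : phase (toℕ i) ≡ ph0 ⊎ phase (toℕ i) ≡ ph2 → advance (phase (toℕ i)) ≡ ph1 ⊎ advance (phase (toℕ i)) ≡ ph3
    odd (inj₁ ph) = inj₁ (cong advance ph)
    odd (inj₂ ph) = inj₂ (cong advance ph)

  prev-link : ∀ i → phase (toℕ i) ≡ ph0 ⊎ phase (toℕ i) ≡ ph2 → IsLink (role (prev i))
  prev-link zero    _    = subst (IsLink ∘ roleℕ) (sym (toℕ-fromℕ m)) (subst IsLink (sym roleℕ-m) isLink)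
  prev-link (suc i) even = subst (IsLink ∘ roleℕ) (sym (toℕ-inject₁ i)) (oddPhase⇒link (toℕ i) (predPhase _ even))

  context : ∀ i → Context i (role i)
  context i with role i | roleView (toℕ i)
  ... | _ | at-end i≡m = linkContext (inj₁ (trans (cong role (next-last i i≡m)) roleℕ-0))
  ... | _ | before-end i+1≡m _ = link′Context (trans (cong roleℕ (trans (toℕ-next i i≢m) i+1≡m)) roleℕ-m)
    where
    i≢m : toℕ i ≢ m
    i≢m i≡m = <-irrefl (trans i≡m (sym i+1≡m)) (n<1+n (toℕ i))
  ... | _ | regular i≢m no-end with phase (toℕ i) in ph
  ...   | ph0 = seedContext (next-link i i≢m (inj₁ ph)) (prev-link i (inj₁ ph))
  ...   | ph2 = peakContext (next-link i i≢m (inj₂ ph)) (prev-link i (inj₂ ph))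
  ...   | ph1 = linkContext (inj₂ (prevSeed i ph))
    where
    prevSeed : ∀ i → phase (toℕ i) ≡ ph1 → role (prev i) ≡ seedV
    prevSeed zero    ()
    prevSeed (suc i) ph = trans (cong roleℕ (toℕ-inject₁ i)) (seedAt (toℕ i) (advance≡ph1 ph) (<⇒≢ (toℕ<n i)))
      where
      advance≡ph1 : ∀ {x} → advance x ≡ ph1 → x ≡ ph0
      advance≡ph1 {ph0} _ = refl
  ...   | ph3 = linkContext (inj₁ (trans (cong roleℕ (toℕ-next i i≢m)) (seedAt (suc (toℕ i)) (cong advance ph) i+1≢m)))
    where
    i+1≢m : suc (toℕ i) ≢ m
    i+1≢m i+1≡m = no-end i+1≡m (trans (sym (cong phase i+1≡m)) (cong advance ph))

  isPeak : Role → Bool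
  isPeak peak = true
  isPeak _    = false

  peakAt : ∀ b → phase b ≡ ph2 → b ≢ m → roleℕ b ≡ peak
  peakAt b ph b≢m with roleℕ b | roleView b
  ... | _ | at-end b≡m            = contradiction b≡m b≢m
  ... | _ | before-end b+1≡m ph-m = contradiction (trans (sym (cong advance ph)) (trans (cong phase b+1≡m) ph-m)) λ ()
  ... | _ | regular _ _           = cong base ph

  peaks : ℕ
  peaks = count (isPeak ∘ role)

  ph2Count≤peaks : ph2Count m ≤ peaks
  ph2Count≤peaks = begin
    ph2Count m                            ≤⟨ count-mono ph2⇒peak ⟩
    count (isPeak ∘ role ∘ inject₁)       ≤⟨ m≤m+n _ _ ⟩
    count (isPeak ∘ role ∘ inject₁) + iverson (isPeak (role (fromℕ m))) ≡⟨ sum-init-last (iverson ∘ isPeak ∘ role) ⟨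
    peaks                                 ∎
    where
    open ≤-Reasoning
    ph2⇒peak : ∀ i → isPh2 (phase (toℕ i)) ≡ true → isPeak (role (inject₁ i)) ≡ true
    ph2⇒peak i at-ph2 = cong isPeak (trans (cong roleℕ (toℕ-inject₁ i)) (peakAt (toℕ i) (isPh2-sound at-ph2) (<⇒≢ (toℕ<n i))))
      where
      isPh2-sound : ∀ {x} → isPh2 x ≡ true → x ≡ ph2
      isPh2-sound {ph2} _ = refl

module PeakConstruction (m p k : ℕ) (2≤m : 2 ≤ m) (2≤k : 2 ≤ k) (k≤p : k ≤ p) where

  open DoubleCorona m p
  open PeakPattern m 2≤m public

  leftTime rightTime late zeroCount : Role → ℕ
  leftTime seedV = 0
  leftTime peak  = 3
  leftTime link  = 1
  leftTime link′ = 2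
  rightTime seedV = 5
  rightTime peak  = 5
  rightTime link  = 3
  rightTime link′ = 4
  late seedV = 6
  late peak  = 6
  late link  = 2
  late link′ = 3
  zeroCount seedV = k ∸ 2
  zeroCount peak  = k ∸ 2
  zeroCount link  = k ∸ 1
  zeroCount link′ = k ∸ 1

  open StaggeredSchedule m p role leftTime rightTime zeroCount late public renaming (schedule to peaked)

  zeroCount≤p : ∀ r → zeroCount r ≤ p
  zeroCount≤p seedV = ≤-trans (m∸n≤m k 2) k≤p
  zeroCount≤p peak  = ≤-trans (m∸n≤m k 2) k≤p
  zeroCount≤p link  = ≤-trans (m∸n≤m k 1) k≤p
  zeroCount≤p link′ = ≤-trans (m∸n≤m k 1) k≤p

  link-times : ∀ {r} → IsLink r → leftTime r ≤ 2 × rightTime r ≤ 4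
  link-times isLink  = s≤s z≤n , s≤s (s≤s (s≤s z≤n))
  link-times isLink′ = ≤-refl , ≤-refl

  k≡k∸2+2 : k ≡ k ∸ 2 + 2
  k≡k∸2+2 = sym (m∸n+n≡m 2≤k)

  k≡k∸1+1 : k ≡ k ∸ 1 + 1
  k≡k∸1+1 = sym (m∸n+n≡m (≤-trans (s≤s z≤n) 2≤k))

  peaked-cyc-ok : ∀ s i → 0 < peaked (cyc s i) → k ≤ cycNbrs (λ κ → peaked κ <ᵇ peaked (cyc s i)) s i
  peaked-cyc-ok left i pos with role i | context i
  ... | _ | peakContext next-link prev-link = ≤-trans (≤-reflexive k≡k∸2+2)
        (+-mono-≤ (staggered-before (zeroCount≤p peak) pos)
                  (+-mono-≤ (earlierBy (s≤s (proj₁ (link-times next-link)))) (earlierBy (s≤s (proj₁ (link-times prev-link))))))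
  ... | _ | linkContext (inj₁ next-seed) = ≤-trans (≤-reflexive k≡k∸1+1)
        (+-mono-≤ (staggered-before (zeroCount≤p link) pos)
                  (≤-trans (earlierBy (subst (λ r → leftTime r < 1) (sym next-seed) z<s)) (m≤m+n _ _)))
  ... | _ | linkContext (inj₂ prev-seed) = ≤-trans (≤-reflexive k≡k∸1+1)
        (+-mono-≤ (staggered-before (zeroCount≤p link) pos)
                  (≤-trans (earlierBy (subst (λ r → leftTime r < 1) (sym prev-seed) z<s)) (m≤n+m _ _)))
  ... | _ | link′Context next-link = ≤-trans (≤-reflexive k≡k∸1+1)
        (+-mono-≤ (staggered-before (zeroCount≤p link′) pos)
                  (≤-trans (earlierBy (subst (λ r → leftTime r < 2) (sym next-link) (s≤s (s≤s z≤n)))) (m≤m+n _ _)))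
  peaked-cyc-ok right i pos with role i | context i
  ... | _ | seedContext next-link prev-link = ≤-trans (≤-reflexive k≡k∸2+2)
        (+-mono-≤ (staggered-before (zeroCount≤p seedV) pos)
                  (+-mono-≤ (earlierBy (s≤s (proj₂ (link-times next-link)))) (earlierBy (s≤s (proj₂ (link-times prev-link))))))
  ... | _ | peakContext next-link prev-link = ≤-trans (≤-reflexive k≡k∸2+2)
        (+-mono-≤ (staggered-before (zeroCount≤p peak) pos)
                  (+-mono-≤ (earlierBy (s≤s (proj₂ (link-times next-link)))) (earlierBy (s≤s (proj₂ (link-times prev-link))))))
  ... | _ | linkContext _  = ≤-trans k≤p (≤-trans (≤-reflexive (sym (staggered-allBefore {z = zeroCount link} {late = late link} ≤-refl))) (m≤m+n _ _))
  ... | _ | link′Context _ = ≤-trans k≤p (≤-trans (≤-reflexive (sym (staggered-allBefore {z = zeroCount link′} {late = late link′} ≤-refl))) (m≤m+n _ _))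

  peaked-pend-ok : ∀ i a → 0 < peaked (uK i a) → k ≤ pendNbrs (λ κ → peaked κ <ᵇ peaked (uK i a)) i a
  peaked-pend-ok i a pos with role i
  ... | seedV = ≤-trans (≤-reflexive k≡k∸2+2) (+-mono-≤ (staggered-clique (zeroCount≤p seedV) a pos)
                  (+-mono-≤ (before-late (s≤s z≤n)) (before-late ≤-refl)))
    where before-late = beforeActivePendant seedV pos
  ... | peak  = ≤-trans (≤-reflexive k≡k∸2+2) (+-mono-≤ (staggered-clique (zeroCount≤p peak) a pos)
                  (+-mono-≤ (before-late (s≤s (s≤s (s≤s (s≤s z≤n))))) (before-late ≤-refl)))
    where before-late = beforeActivePendant peak pos
  ... | link  = ≤-trans (≤-reflexive k≡k∸1+1) (+-mono-≤ (staggered-clique (zeroCount≤p link) a pos)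
                  (≤-trans (beforeActivePendant link pos ≤-refl) (m≤m+n _ _)))
  ... | link′ = ≤-trans (≤-reflexive k≡k∸1+1) (+-mono-≤ (staggered-clique (zeroCount≤p link′) a pos)
                  (≤-trans (beforeActivePendant link′ pos ≤-refl) (m≤m+n _ _)))

  peaked-valid : IsLocalSchedule k peaked
  peaked-valid = record { cyc-ok = peaked-cyc-ok ; pend-ok = peaked-pend-ok }

  k∸2+1 : suc (k ∸ 2) ≡ k ∸ 1
  k∸2+1 = sym (+-∸-assoc 1 2≤k)

  groupZeros-peaks : ∀ r → groupZeros r + iverson (isPeak r) ≡ k ∸ 1
  groupZeros-peaks seedV = trans (+-identityʳ _) k∸2+1
  groupZeros-peaks peak  = trans (+-comm (k ∸ 2) 1) k∸2+1
  groupZeros-peaks link  = +-identityʳ _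
  groupZeros-peaks link′ = +-identityʳ _

  peaked-zeros≤ : kindZeros peaked ≤ (k ∸ 2) * n + (3 * n + 3) / 4
  peaked-zeros≤ = +-cancelʳ-≤ peaks _ _ (begin
    kindZeros peaked + peaks                      ≡⟨ cong (_+ peaks) (kindZeros-schedule zeroCount≤p late>0) ⟩
    sum (groupZeros ∘ role) + peaks               ≡⟨ ∑-distrib-+ (groupZeros ∘ role) (iverson ∘ isPeak ∘ role) ⟨
    sum (λ i → groupZeros (role i) + iverson (isPeak (role i))) ≡⟨ sum-cong-≗ (groupZeros-peaks ∘ role) ⟩
    sum {n} (λ _ → k ∸ 1)                         ≡⟨ trans (sum-const n (k ∸ 1)) (*-comm n (k ∸ 1)) ⟩
    (k ∸ 1) * n                                   ≡⟨ cong (_* n) k∸2+1 ⟨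
    n + (k ∸ 2) * n                               ≤⟨ +-monoˡ-≤ _ (quarter-bound n peaks n≤4peaks+3) ⟩
    (3 * n + 3) / 4 + peaks + (k ∸ 2) * n         ≡⟨ trans (+-comm _ ((k ∸ 2) * n)) (sym (+-assoc ((k ∸ 2) * n) _ peaks)) ⟩
    (k ∸ 2) * n + (3 * n + 3) / 4 + peaks         ∎)
    where
    open ≤-Reasoning
    late>0 : ∀ r → 0 < late r
    late>0 seedV = z<s
    late>0 peak  = z<s
    late>0 link  = z<s
    late>0 link′ = z<s
    n≤4peaks+3 : n ≤ 4 * peaks + 3
    n≤4peaks+3 = begin
      suc m                      ≤⟨ s≤s (ph2Count-bound m) ⟩
      suc (4 * ph2Count m + 2)   ≡⟨ +-suc (4 * ph2Count m) 2 ⟨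
      4 * ph2Count m + 3         ≤⟨ +-monoˡ-≤ 3 (*-monoʳ-≤ 4 ph2Count≤peaks) ⟩
      4 * peaks + 3              ∎

mainTheorem8 : (n p k : ℕ) → 3 ≤ n → 2 ≤ k →
    (k ≤ p → ConvNumberIs (doubleCorona n p) k ((k ∸ 2) * n + (3 * n + 3) / 4)) ×
    (k ≡ p + 1 → ConvNumberIs (doubleCorona n p) k (p * n)) ×
    (k ≡ p + 2 → ConvNumberIs (doubleCorona n p) k (p * n + 2 * ⌈ n /2⌉)) ×
    (p + 3 ≤ k → Inconvertible (doubleCorona n p) k)
mainTheorem8 (suc m) p k (s≤s 2≤m) 2≤k = case-≤p , case-p+1 , case-p+2 , case-≥p+3
  where
  open DoubleCorona m p
  open LowerBound m p k

  case-≤p : k ≤ p → ConvNumberIs G k ((k ∸ 2) * n + (3 * n + 3) / 4)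
  case-≤p k≤p = convNumber-local 2≤m peaked peaked-valid (≤-antisym peaked-zeros≤ (lower peaked peaked-valid)) lower
    where
    open PeakConstruction m p k 2≤m 2≤k k≤p
    lower : ∀ T → IsLocalSchedule k T → (k ∸ 2) * n + (3 * n + 3) / 4 ≤ kindZeros T
    lower T valid = lowerBound-≤p T valid k≤p 2≤k

  case-p+1 : k ≡ p + 1 → ConvNumberIs G k (p * n)
  case-p+1 refl = convNumber-local 2≤m seeded seeded-valid seeded-zeros (λ T valid → lowerBound-p+1 T valid refl)
    where open SeedConstruction m p 2≤m (+-cancelʳ-≤ 1 1 p 2≤k)

  case-p+2 : k ≡ p + 2 → ConvNumberIs G k (p * n + 2 * ⌈ n /2⌉)
  case-p+2 k≡ = convNumber-local 2≤m alternating (alternating-valid k≡) alternating-zeros (λ T valid → lowerBound-p+2 T valid k≡)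
    where open AlternatingConstruction m p

  case-≥p+3 : p + 3 ≤ k → Inconvertible G k
  case-≥p+3 p+3≤k = convNumber-local 2≤m (λ _ → 0) inactive-local (kindZeros-inactive _ λ _ → refl)
                      (λ T valid → ≤-reflexive (sym (kindZeros-inactive T (inactive T valid p+3≤k))))
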